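{- $$\sum_{n\ge0}(1\text{ - }2]\mathcal{S}_n(2\text{ - }3\text{ - }1)z^n=z^2BC^4,\qquad \sum_{n\ge0}(2\text{ - }1]\mathcal{S}_n(2\text{ - }3\text{ - }1)z^n=z^2C^4,$$ $$\sum_{n\ge0}(12]\mathcal{S}_n(2\text{ - }3\text{ - }1)z^n=z^2C^3,\qquad \sum_{n\ge0}(21]\mathcal{S}_n(2\text{ - }3\text{ - }1)z^n=z^2C^2.$$
   Context: $\mathcal{S}_n(2\text{ - }3\text{ - }1)$ is the set of permutations $\sigma$ of $\{1,\dots,n\}$ with no $i<j<k$ such that $\sigma_k<\sigma_i<\sigma_j$. For $\pi=\pi_1\cdots\pi_n$: $(1\text{ - }2]\pi$ is the number of $i<n$ with $\pi_i<\pi_n$; $(2\text{ - }1]\pi$ is the number of $i<n$ with $\pi_i>\pi_n$; $(12]\pi$ equals $1$ if $n\ge2$ and $\pi_{n-1}<\pi_n$, and $0$ otherwise; $(21]\pi$ equals $1$ if $n\ge2$ and $\pi_{n-1}>\pi_n$, and $0$ otherwise. For a set $S$, $(\tau]S=\sum_{\pi\in S}(\tau]\pi$. $B=\frac{1}{\sqrt{1-4z}}$, $C=\frac{1-\sqrt{1-4z}}{2z}$. -}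

module Defs where

open import Data.Bool using (Bool; true; false; _∧_; _∨_; not; if_then_else_)
open import Data.Nat using (ℕ; zero; suc; _∸_; _<ᵇ_; _≡ᵇ_)
import Data.Nat as ℕ
open import Data.Integer using (ℤ; +_; _-_)
import Data.Integer as ℤ
open import Data.List using (List; []; _∷_; map; concatMap; upTo; filterᵇ; reverse; foldr; length)
open import Data.Bool.ListAction using (any; all)
open import Relation.Binary.PropositionalEquality using (_≡_)

-- Permutations of {1..n}, represented (0-based) as lists of length n
-- with entries in {0..n-1}, pairwise distinct.  Relative order, hence all
-- pattern/statistic notions, is unaffected by the shift 1..n ↦ 0..n-1.

words : ℕ → ℕ → List (List ℕ)
words zero    m = [] ∷ []
words (suc k) m = concatMap (λ x → map (x ∷_) (words k m)) (upTo m)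

distinct : List ℕ → Bool
distinct []       = true
distinct (x ∷ xs) = all (λ y → not (x ≡ᵇ y)) xs ∧ distinct xs

perms : ℕ → List (List ℕ)
perms n = filterᵇ distinct (words n n)

231-from : ℕ → List ℕ → Bool
231-from a []       = false
231-from a (b ∷ cs) = ((a <ᵇ b) ∧ any (λ c → c <ᵇ a) cs) ∨ 231-from a cs

contains231 : List ℕ → Bool
contains231 []       = false
contains231 (a ∷ as) = 231-from a as ∨ contains231 as

avoiders231 : ℕ → List (List ℕ)
avoiders231 n = filterᵇ (λ π → not (contains231 π)) (perms n)

count : (ℕ → Bool) → List ℕ → ℕ
count p xs = length (filterᵇ p xs)

b2n : Bool → ℕ
b2n true  = 1
b2n false = 0

stat-1-2] : List ℕ → ℕ      -- #{i<n : π_i < π_n}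
stat-1-2] π with reverse π
... | []      = 0
... | x ∷ xs  = count (λ y → y <ᵇ x) xs

stat-2-1] : List ℕ → ℕ      -- #{i<n : π_i > π_n}
stat-2-1] π with reverse π
... | []      = 0
... | x ∷ xs  = count (λ y → x <ᵇ y) xs

stat12] : List ℕ → ℕ        -- [n ≥ 2 and π_{n-1} < π_n]
stat12] π with reverse π
... | x ∷ y ∷ _ = b2n (y <ᵇ x)
... | _         = 0

stat21] : List ℕ → ℕ        -- [n ≥ 2 and π_{n-1} > π_n]
stat21] π with reverse π
... | x ∷ y ∷ _ = b2n (x <ᵇ y)
... | _         = 0

total : (List ℕ → ℕ) → List (List ℕ) → ℕ
total f S = foldr (λ π acc → f π ℕ.+ acc) 0 S

Series : Set
Series = ℕ → ℤ

sumℤ : List ℤ → ℤ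
sumℤ = foldr ℤ._+_ (+ 0)

_*ₛ_ : Series → Series → Series
(f *ₛ g) n = sumℤ (map (λ k → f k ℤ.* g (n ∸ k)) (upTo (suc n)))

_-ₛ_ : Series → Series → Series
(f -ₛ g) n = f n - g n

infixl 7 _*ₛ_
infixl 6 _-ₛ_
infix 4 _≈ₛ_

const : ℤ → Series
const c zero    = c
const c (suc _) = + 0

cz : ℤ → Series
cz c zero          = + 0
cz c (suc zero)    = c
cz c (suc (suc _)) = + 0

z²· : Series → Series
z²· f zero          = + 0
z²· f (suc zero)    = + 0
z²· f (suc (suc n)) = f n

_≈ₛ_ : Series → Series → Set
f ≈ₛ g = ∀ n → f n ≡ g n

gf : (List ℕ → ℕ) → Series
gf stat n = + total stat (avoiders231 n)

module Submission where

-- Every 2-3-1 avoider of size n + 1 factors uniquely as α n (k + β) around its maximum n,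
-- with α and β avoiders of sizes k and n - k; hence the series A of avoider counts satisfies
-- A = 1 + z A².  Under this gluing each of the four statistics of the last entry changes by a
-- weight u(k) v(n - k) plus its value on β, so its generating function G satisfies the linear
-- equation G = z (U V + A G), with U, V the avoider counts weighted by u, v.  For (1-2] the
-- weight is k and U = z A' is found in the same way from A' = A² + 2 z A A'.  On the other side,
-- the hypotheses on S, B, C force C = 1 + z C² and B = 1 + 2 z B C, so A = C, and the claimed
-- closed forms satisfy the same equations; such equations have unique power-series solutions.

module PowerSeries where

  open import Defs
  open import Algebra.Bundles using (CommutativeSemiring)
  open import Algebra.Structures using (IsCommutativeMonoid)
  open import Algebra.Structures.Biased using (isCommutativeSemiringˡ)
  open import Data.Integer using (ℤ; +_; _+_; _*_)
  import Data.Integer.Properties as ℤ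
  open import Algebra.Properties.CommutativeSemigroup ℤ.+-commutativeSemigroup
    using () renaming (interchange to +-interchange; x∙yz≈y∙xz to x+yz≈y+xz)
  open import Data.Integer.Tactic.RingSolver using (solve-∀)
  open import Data.List using (applyUpTo)
  open import Data.List.Properties using (map-applyUpTo)
  open import Data.Nat using (ℕ; zero; suc; _∸_; _≤_; _<_; z≤n; s≤s)
  import Data.Nat as ℕ
  open import Data.Nat.Properties using (m∸n≤m; m+[n∸m]≡n; ≤-refl; ≤-trans)
  open import Data.Product using (_,_)
  open import Function using (_∘_)
  open import Level using (0ℓ)
  open import Relation.Binary.PropositionalEquality
  open import Relation.Binary.Structures using (IsEquivalence)
  open ≡-Reasoning

  infixl 6 _+ₛ_

  _+ₛ_ : Series → Series → Series
  (f +ₛ g) n = f n + g n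

  𝟘 𝟙 Z : Series
  𝟘 _ = + 0
  𝟙 = const (+ 1)
  Z = cz (+ 1)

  infixl 6 _⟨+⟩_
  infixl 7 _⟨*⟩_
  infixr 4 _⟨≈⟩_

  ≈ₛ-refl : ∀ {f} → f ≈ₛ f
  ≈ₛ-refl _ = refl

  _⟨≈⟩_ : ∀ {f g h} → f ≈ₛ g → g ≈ₛ h → f ≈ₛ h
  (e ⟨≈⟩ e') n = trans (e n) (e' n)

  _⟨+⟩_ : ∀ {f f' g g'} → f ≈ₛ f' → g ≈ₛ g' → f +ₛ g ≈ₛ f' +ₛ g'
  (e ⟨+⟩ e') n = cong₂ _+_ (e n) (e' n)

  ≈ₛ-isEquivalence : IsEquivalence _≈ₛ_
  ≈ₛ-isEquivalence = record { refl = ≈ₛ-refl ; sym = λ e n → sym (e n) ; trans = _⟨≈⟩_ }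

  sumUpTo : (ℕ → ℤ) → ℕ → ℤ
  sumUpTo h m = sumℤ (applyUpTo h m)

  sumUpTo-cong : ∀ {h h'} m → (∀ k → k < m → h k ≡ h' k) → sumUpTo h m ≡ sumUpTo h' m
  sumUpTo-cong zero    e = refl
  sumUpTo-cong (suc m) e = cong₂ _+_ (e 0 (s≤s z≤n)) (sumUpTo-cong m (λ k k<m → e (suc k) (s≤s k<m)))

  sumUpTo-+ : ∀ h h' m → sumUpTo (λ k → h k + h' k) m ≡ sumUpTo h m + sumUpTo h' m
  sumUpTo-+ h h' zero    = refl
  sumUpTo-+ h h' (suc m) = begin
    h 0 + h' 0 + sumUpTo (λ k → h (suc k) + h' (suc k)) m
      ≡⟨ cong (_+_ (h 0 + h' 0)) (sumUpTo-+ (h ∘ suc) (h' ∘ suc) m) ⟩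
    h 0 + h' 0 + (sumUpTo (h ∘ suc) m + sumUpTo (h' ∘ suc) m)
      ≡⟨ +-interchange (h 0) (h' 0) _ _ ⟩
    h 0 + sumUpTo (h ∘ suc) m + (h' 0 + sumUpTo (h' ∘ suc) m) ∎

  sumUpTo-*ˡ : ∀ a h m → sumUpTo (λ k → a * h k) m ≡ a * sumUpTo h m
  sumUpTo-*ˡ a h zero    = sym (ℤ.*-zeroʳ a)
  sumUpTo-*ˡ a h (suc m) = trans (cong (_+_ (a * h 0)) (sumUpTo-*ˡ a (h ∘ suc) m)) (sym (ℤ.*-distribˡ-+ a (h 0) _))

  sumUpTo-zero : ∀ h m → (∀ k → h k ≡ + 0) → sumUpTo h m ≡ + 0
  sumUpTo-zero h zero    e = refl
  sumUpTo-zero h (suc m) e = cong₂ _+_ (e 0) (sumUpTo-zero (h ∘ suc) m (e ∘ suc))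

  *ₛ-as-sum : ∀ f g n → (f *ₛ g) n ≡ sumUpTo (λ k → f k * g (n ∸ k)) (suc n)
  *ₛ-as-sum f g n = cong sumℤ (map-applyUpTo (λ k → k) (λ k → f k * g (n ∸ k)) (suc n))

  *ₛ-zero-index : ∀ f g → (f *ₛ g) 0 ≡ f 0 * g 0
  *ₛ-zero-index f g = ℤ.+-identityʳ _

  *ₛ-suc : ∀ f g n → (f *ₛ g) (suc n) ≡ f 0 * g (suc n) + (f ∘ suc *ₛ g) n
  *ₛ-suc f g n = trans (*ₛ-as-sum f g (suc n)) (cong (_+_ (f 0 * g (suc n))) (sym (*ₛ-as-sum (f ∘ suc) g n)))

  *ₛ-cong-≤ : ∀ {f f' g g'} n → (∀ k → k ≤ n → f k ≡ f' k) → (∀ k → k ≤ n → g k ≡ g' k)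
            → (f *ₛ g) n ≡ (f' *ₛ g') n
  *ₛ-cong-≤ {f} {f'} {g} {g'} n ef eg = begin
    (f *ₛ g) n                            ≡⟨ *ₛ-as-sum f g n ⟩
    sumUpTo (λ k → f k * g (n ∸ k)) (suc n)
      ≡⟨ sumUpTo-cong (suc n) (λ { k (s≤s k≤n) → cong₂ _*_ (ef k k≤n) (eg (n ∸ k) (m∸n≤m n k)) }) ⟩
    sumUpTo (λ k → f' k * g' (n ∸ k)) (suc n) ≡⟨ *ₛ-as-sum f' g' n ⟨
    (f' *ₛ g') n                          ∎

  *ₛ-cong : ∀ {f f' g g'} → f ≈ₛ f' → g ≈ₛ g' → f *ₛ g ≈ₛ f' *ₛ g'
  *ₛ-cong ef eg n = *ₛ-cong-≤ n (λ k _ → ef k) (λ k _ → eg k)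

  _⟨*⟩_ : ∀ {f f' g g'} → f ≈ₛ f' → g ≈ₛ g' → f *ₛ g ≈ₛ f' *ₛ g'
  _⟨*⟩_ = *ₛ-cong

  *ₛ-zeroˡ : ∀ {f} g → f ≈ₛ 𝟘 → f *ₛ g ≈ₛ 𝟘
  *ₛ-zeroˡ {f} g f≈0 n = trans (*ₛ-as-sum f g n)
    (sumUpTo-zero _ (suc n) (λ k → trans (cong (_* g (n ∸ k)) (f≈0 k)) (ℤ.*-zeroˡ (g (n ∸ k)))))

  *ₛ-distribʳ : ∀ f g h → (g +ₛ h) *ₛ f ≈ₛ g *ₛ f +ₛ h *ₛ f
  *ₛ-distribʳ f g h n = begin
    ((g +ₛ h) *ₛ f) n                            ≡⟨ *ₛ-as-sum (g +ₛ h) f n ⟩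
    sumUpTo (λ k → (g k + h k) * f (n ∸ k)) (suc n)
      ≡⟨ sumUpTo-cong (suc n) (λ k _ → ℤ.*-distribʳ-+ (f (n ∸ k)) (g k) (h k)) ⟩
    sumUpTo (λ k → g k * f (n ∸ k) + h k * f (n ∸ k)) (suc n)
      ≡⟨ sumUpTo-+ (λ k → g k * f (n ∸ k)) (λ k → h k * f (n ∸ k)) (suc n) ⟩
    sumUpTo (λ k → g k * f (n ∸ k)) (suc n) + sumUpTo (λ k → h k * f (n ∸ k)) (suc n)
      ≡⟨ cong₂ _+_ (*ₛ-as-sum g f n) (*ₛ-as-sum h f n) ⟨
    (g *ₛ f +ₛ h *ₛ f) n                         ∎

  const-*ₛ : ∀ a g n → (const a *ₛ g) n ≡ a * g n
  const-*ₛ a g zero    = *ₛ-zero-index (const a) g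
  const-*ₛ a g (suc n) = begin
    (const a *ₛ g) (suc n)                   ≡⟨ *ₛ-suc (const a) g n ⟩
    a * g (suc n) + (const a ∘ suc *ₛ g) n   ≡⟨ cong (_+_ (a * g (suc n))) (*ₛ-zeroˡ g ≈ₛ-refl n) ⟩
    a * g (suc n) + + 0                      ≡⟨ ℤ.+-identityʳ _ ⟩
    a * g (suc n)                            ∎

  *ₛ-identityˡ : ∀ f → 𝟙 *ₛ f ≈ₛ f
  *ₛ-identityˡ f n = trans (const-*ₛ (+ 1) f n) (ℤ.*-identityˡ (f n))

  *ₛ-sucʳ : ∀ f g n → (f *ₛ g) (suc n) ≡ f (suc n) * g 0 + (f *ₛ g ∘ suc) n
  *ₛ-sucʳ f g zero = begin
    f 0 * g 1 + (f ∘ suc *ₛ g) 0    ≡⟨ cong (_+_ (f 0 * g 1)) (*ₛ-zero-index (f ∘ suc) g) ⟩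
    f 0 * g 1 + f 1 * g 0           ≡⟨ ℤ.+-comm (f 0 * g 1) _ ⟩
    f 1 * g 0 + f 0 * g 1           ≡⟨ cong (_+_ (f 1 * g 0)) (*ₛ-zero-index f (g ∘ suc)) ⟨
    f 1 * g 0 + (f *ₛ g ∘ suc) 0    ∎
  *ₛ-sucʳ f g (suc n) = begin
    (f *ₛ g) (suc (suc n))
      ≡⟨ *ₛ-suc f g (suc n) ⟩
    f 0 * g (suc (suc n)) + (f ∘ suc *ₛ g) (suc n)
      ≡⟨ cong (_+_ (f 0 * g (suc (suc n)))) (*ₛ-sucʳ (f ∘ suc) g n) ⟩
    f 0 * g (suc (suc n)) + (f (suc (suc n)) * g 0 + (f ∘ suc *ₛ g ∘ suc) n)
      ≡⟨ x+yz≈y+xz (f 0 * g (suc (suc n))) (f (suc (suc n)) * g 0) ((f ∘ suc *ₛ g ∘ suc) n) ⟩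
    f (suc (suc n)) * g 0 + (f 0 * g (suc (suc n)) + (f ∘ suc *ₛ g ∘ suc) n)
      ≡⟨ cong (_+_ (f (suc (suc n)) * g 0)) (*ₛ-suc f (g ∘ suc) n) ⟨
    f (suc (suc n)) * g 0 + (f *ₛ g ∘ suc) (suc n) ∎

  *ₛ-comm : ∀ f g → f *ₛ g ≈ₛ g *ₛ f
  *ₛ-comm f g zero    = trans (*ₛ-zero-index f g) (trans (ℤ.*-comm (f 0) (g 0)) (sym (*ₛ-zero-index g f)))
  *ₛ-comm f g (suc n) = begin
    (f *ₛ g) (suc n)                      ≡⟨ *ₛ-suc f g n ⟩
    f 0 * g (suc n) + (f ∘ suc *ₛ g) n    ≡⟨ cong₂ _+_ (ℤ.*-comm (f 0) _) (*ₛ-comm (f ∘ suc) g n) ⟩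
    g (suc n) * f 0 + (g *ₛ f ∘ suc) n    ≡⟨ *ₛ-sucʳ g f n ⟨
    (g *ₛ f) (suc n)                      ∎

  *ₛ-∘suc : ∀ f g → (f *ₛ g) ∘ suc ≈ₛ const (f 0) *ₛ g ∘ suc +ₛ f ∘ suc *ₛ g
  *ₛ-∘suc f g n = trans (*ₛ-suc f g n) (cong (_+ (f ∘ suc *ₛ g) n) (sym (const-*ₛ (f 0) (g ∘ suc) n)))

  *ₛ-assoc : ∀ f g h → f *ₛ g *ₛ h ≈ₛ f *ₛ (g *ₛ h)
  *ₛ-assoc f g h zero = begin
    ((f *ₛ g) *ₛ h) 0     ≡⟨ *ₛ-zero-index (f *ₛ g) h ⟩
    (f *ₛ g) 0 * h 0      ≡⟨ cong (_* h 0) (*ₛ-zero-index f g) ⟩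
    f 0 * g 0 * h 0       ≡⟨ ℤ.*-assoc (f 0) _ _ ⟩
    f 0 * (g 0 * h 0)     ≡⟨ cong (f 0 *_) (*ₛ-zero-index g h) ⟨
    f 0 * (g *ₛ h) 0      ≡⟨ *ₛ-zero-index f (g *ₛ h) ⟨
    (f *ₛ (g *ₛ h)) 0     ∎
  *ₛ-assoc f g h (suc n) = begin
    (f *ₛ g *ₛ h) (suc n)
      ≡⟨ *ₛ-suc (f *ₛ g) h n ⟩
    (f *ₛ g) 0 * h (suc n) + ((f *ₛ g) ∘ suc *ₛ h) n
      ≡⟨ cong₂ _+_ (cong (_* h (suc n)) (*ₛ-zero-index f g)) ((*ₛ-∘suc f g ⟨*⟩ ≈ₛ-refl {h}) n) ⟩
    f 0 * g 0 * h (suc n) + ((const (f 0) *ₛ g ∘ suc +ₛ f ∘ suc *ₛ g) *ₛ h) n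
      ≡⟨ cong (_+_ (f 0 * g 0 * h (suc n))) (*ₛ-distribʳ h (const (f 0) *ₛ g ∘ suc) (f ∘ suc *ₛ g) n) ⟩
    f 0 * g 0 * h (suc n) + ((const (f 0) *ₛ g ∘ suc *ₛ h) n + (f ∘ suc *ₛ g *ₛ h) n)
      ≡⟨ cong (_+_ (f 0 * g 0 * h (suc n))) (cong₂ _+_
           (trans (*ₛ-assoc (const (f 0)) (g ∘ suc) h n) (const-*ₛ (f 0) (g ∘ suc *ₛ h) n))
           (*ₛ-assoc (f ∘ suc) g h n)) ⟩
    f 0 * g 0 * h (suc n) + (f 0 * (g ∘ suc *ₛ h) n + (f ∘ suc *ₛ (g *ₛ h)) n)
      ≡⟨ factor (f 0) (g 0) (h (suc n)) _ _ ⟩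
    f 0 * (g 0 * h (suc n) + (g ∘ suc *ₛ h) n) + (f ∘ suc *ₛ (g *ₛ h)) n
      ≡⟨ cong (λ t → f 0 * t + (f ∘ suc *ₛ (g *ₛ h)) n) (*ₛ-suc g h n) ⟨
    f 0 * (g *ₛ h) (suc n) + (f ∘ suc *ₛ (g *ₛ h)) n
      ≡⟨ *ₛ-suc f (g *ₛ h) n ⟨
    (f *ₛ (g *ₛ h)) (suc n) ∎
    where
    factor : ∀ a b c x y → a * b * c + (a * x + y) ≡ a * (b * c + x) + y
    factor = solve-∀

  +ₛ-isCommutativeMonoid : IsCommutativeMonoid _≈ₛ_ _+ₛ_ 𝟘
  +ₛ-isCommutativeMonoid = record
    { isMonoid = record
      { isSemigroup = record
        { isMagma = record { isEquivalence = ≈ₛ-isEquivalence ; ∙-cong = _⟨+⟩_ }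
        ; assoc = λ f g h n → ℤ.+-assoc (f n) (g n) (h n) }
      ; identity = (λ f n → ℤ.+-identityˡ (f n)) , (λ f n → ℤ.+-identityʳ (f n)) }
    ; comm = λ f g n → ℤ.+-comm (f n) (g n) }

  *ₛ-isCommutativeMonoid : IsCommutativeMonoid _≈ₛ_ _*ₛ_ 𝟙
  *ₛ-isCommutativeMonoid = record
    { isMonoid = record
      { isSemigroup = record
        { isMagma = record { isEquivalence = ≈ₛ-isEquivalence ; ∙-cong = *ₛ-cong }
        ; assoc = *ₛ-assoc }
      ; identity = *ₛ-identityˡ , (λ f n → trans (*ₛ-comm f 𝟙 n) (*ₛ-identityˡ f n)) }
    ; comm = *ₛ-comm }

  series-commutativeSemiring : CommutativeSemiring 0ℓ 0ℓ
  series-commutativeSemiring = record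
    { isCommutativeSemiring = isCommutativeSemiringˡ (record
        { +-isCommutativeMonoid = +ₛ-isCommutativeMonoid
        ; *-isCommutativeMonoid = *ₛ-isCommutativeMonoid
        ; distribʳ = *ₛ-distribʳ
        ; zeroˡ = λ f → *ₛ-zeroˡ f ≈ₛ-refl }) }

  open import Algebra.Solver.Ring.NaturalCoefficients.Default series-commutativeSemiring public
    using (solve; _:=_; _:+_; _:*_; con)

  cz-*ₛ-zero : ∀ c G → (cz c *ₛ G) 0 ≡ + 0
  cz-*ₛ-zero c G = trans (*ₛ-zero-index (cz c) G) (ℤ.*-zeroˡ (G 0))

  cz-*ₛ-suc : ∀ c G n → (cz c *ₛ G) (suc n) ≡ c * G n
  cz-*ₛ-suc c G n = begin
    (cz c *ₛ G) (suc n)                      ≡⟨ *ₛ-suc (cz c) G n ⟩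
    + 0 * G (suc n) + (cz c ∘ suc *ₛ G) n    ≡⟨ ℤ.+-identityˡ _ ⟩
    (cz c ∘ suc *ₛ G) n                      ≡⟨ (cz-shift ⟨*⟩ ≈ₛ-refl {G}) n ⟩
    (const c *ₛ G) n                         ≡⟨ const-*ₛ c G n ⟩
    c * G n                                  ∎
    where
    cz-shift : cz c ∘ suc ≈ₛ const c
    cz-shift zero    = refl
    cz-shift (suc _) = refl

  Z*ₛ-zero : ∀ G → (Z *ₛ G) 0 ≡ + 0
  Z*ₛ-zero = cz-*ₛ-zero (+ 1)

  Z*ₛ-suc : ∀ G n → (Z *ₛ G) (suc n) ≡ G n
  Z*ₛ-suc G n = trans (cz-*ₛ-suc (+ 1) G n) (ℤ.*-identityˡ (G n))

  z²·≈Z*ₛZ*ₛ : ∀ G → z²· G ≈ₛ Z *ₛ (Z *ₛ G)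
  z²·≈Z*ₛZ*ₛ G zero          = sym (Z*ₛ-zero (Z *ₛ G))
  z²·≈Z*ₛZ*ₛ G (suc zero)    = sym (trans (Z*ₛ-suc (Z *ₛ G) 0) (Z*ₛ-zero G))
  z²·≈Z*ₛZ*ₛ G (suc (suc n)) = sym (trans (Z*ₛ-suc (Z *ₛ G) (suc n)) (Z*ₛ-suc G n))

  ≈ₛ-by-prefix-induction : ∀ {X Y} → X 0 ≡ Y 0
    → (∀ n → (∀ k → k ≤ n → X k ≡ Y k) → X (suc n) ≡ Y (suc n)) → X ≈ₛ Y
  ≈ₛ-by-prefix-induction {X} {Y} base step n = prefix n n ≤-refl
    where
    prefix : ∀ m k → k ≤ m → X k ≡ Y k
    prefix m       zero    _         = base
    prefix (suc m) (suc k) (s≤s k≤m) = step k (λ j j≤k → prefix m j (≤-trans j≤k k≤m))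

  linear-equation-unique : ∀ {P F X Y} → X ≈ₛ Z *ₛ (P +ₛ F *ₛ X) → Y ≈ₛ Z *ₛ (P +ₛ F *ₛ Y) → X ≈ₛ Y
  linear-equation-unique {P} {F} {X} {Y} hX hY = ≈ₛ-by-prefix-induction
    (trans (hX 0) (trans (Z*ₛ-zero (P +ₛ F *ₛ X)) (sym (trans (hY 0) (Z*ₛ-zero (P +ₛ F *ₛ Y))))))
    λ n X≡Y → begin
      X (suc n)          ≡⟨ trans (hX (suc n)) (Z*ₛ-suc (P +ₛ F *ₛ X) n) ⟩
      P n + (F *ₛ X) n   ≡⟨ cong (_+_ (P n)) (*ₛ-cong-≤ {F} {F} n (λ _ _ → refl) X≡Y) ⟩
      P n + (F *ₛ Y) n   ≡⟨ trans (hY (suc n)) (Z*ₛ-suc (P +ₛ F *ₛ Y) n) ⟨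
      Y (suc n)          ∎

  quadratic-equation-unique : ∀ {X Y} → X ≈ₛ 𝟙 +ₛ Z *ₛ (X *ₛ X) → Y ≈ₛ 𝟙 +ₛ Z *ₛ (Y *ₛ Y) → X ≈ₛ Y
  quadratic-equation-unique {X} {Y} hX hY = ≈ₛ-by-prefix-induction
    (trans (hX 0) (trans (cong (_+_ (+ 1)) (Z*ₛ-zero (X *ₛ X))) (sym (trans (hY 0) (cong (_+_ (+ 1)) (Z*ₛ-zero (Y *ₛ Y)))))))
    λ n X≡Y → begin
      X (suc n)     ≡⟨ trans (hX (suc n)) (trans (ℤ.+-identityˡ _) (Z*ₛ-suc (X *ₛ X) n)) ⟩
      (X *ₛ X) n    ≡⟨ *ₛ-cong-≤ n X≡Y X≡Y ⟩
      (Y *ₛ Y) n    ≡⟨ trans (hY (suc n)) (trans (ℤ.+-identityˡ _) (Z*ₛ-suc (Y *ₛ Y) n)) ⟨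
      Y (suc n)     ∎

  θ : Series → Series
  θ f k = + k * f k

  θ-*ₛ : ∀ f g → θ (f *ₛ g) ≈ₛ θ f *ₛ g +ₛ f *ₛ θ g
  θ-*ₛ f g n = begin
    + n * (f *ₛ g) n
      ≡⟨ cong (+ n *_) (*ₛ-as-sum f g n) ⟩
    + n * sumUpTo (λ k → f k * g (n ∸ k)) (suc n)
      ≡⟨ sumUpTo-*ˡ (+ n) (λ k → f k * g (n ∸ k)) (suc n) ⟨
    sumUpTo (λ k → + n * (f k * g (n ∸ k))) (suc n)
      ≡⟨ sumUpTo-cong (suc n) (λ { k (s≤s k≤n) → split k≤n }) ⟩
    sumUpTo (λ k → θ f k * g (n ∸ k) + f k * θ g (n ∸ k)) (suc n)
      ≡⟨ sumUpTo-+ (λ k → θ f k * g (n ∸ k)) (λ k → f k * θ g (n ∸ k)) (suc n) ⟩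
    sumUpTo (λ k → θ f k * g (n ∸ k)) (suc n) + sumUpTo (λ k → f k * θ g (n ∸ k)) (suc n)
      ≡⟨ cong₂ _+_ (*ₛ-as-sum (θ f) g n) (*ₛ-as-sum f (θ g) n) ⟨
    (θ f *ₛ g +ₛ f *ₛ θ g) n
      ∎
    where
    distribute : ∀ a b x y → (a + b) * (x * y) ≡ a * x * y + x * (b * y)
    distribute = solve-∀
    split : ∀ {k} → k ≤ n → + n * (f k * g (n ∸ k)) ≡ θ f k * g (n ∸ k) + f k * θ g (n ∸ k)
    split {k} k≤n = begin
      + n * (f k * g (n ∸ k))                  ≡⟨ cong (λ m → + m * (f k * g (n ∸ k))) (m+[n∸m]≡n k≤n) ⟨
      + (k ℕ.+ (n ∸ k)) * (f k * g (n ∸ k))    ≡⟨ cong (_* (f k * g (n ∸ k))) (ℤ.pos-+ k (n ∸ k)) ⟩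
      (+ k + + (n ∸ k)) * (f k * g (n ∸ k))    ≡⟨ distribute (+ k) (+ (n ∸ k)) (f k) (g (n ∸ k)) ⟩
      θ f k * g (n ∸ k) + f k * θ g (n ∸ k)    ∎

  ≈ₛ-Z*ₛ : ∀ {G P} → G 0 ≡ + 0 → (∀ n → G (suc n) ≡ P n) → G ≈ₛ Z *ₛ P
  ≈ₛ-Z*ₛ {G} {P} G₀≡0 G-suc zero    = trans G₀≡0 (sym (Z*ₛ-zero P))
  ≈ₛ-Z*ₛ {G} {P} G₀≡0 G-suc (suc n) = trans (G-suc n) (sym (Z*ₛ-suc P n))


module SquareRoot where

  open import Defs
  open PowerSeries
  open import Data.Integer using (ℤ; +_; -[1+_]; -_; _+_; _-_; _*_)
  import Data.Integer.Properties as ℤ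
  open import Data.Integer.Tactic.RingSolver using (solve-∀)
  open import Data.Nat using (zero; suc)
  open import Function using (_∘_)
  open import Relation.Binary.PropositionalEquality
  open ≡-Reasoning

  module _ (S B C : Series)
    (S²≈1-4z : S *ₛ S ≈ₛ const (+ 1) -ₛ cz (+ 4))
    (S₀≡1 : S 0 ≡ + 1)
    (B*S≈1 : B *ₛ S ≈ₛ const (+ 1))
    (2zC≈1-S : cz (+ 2) *ₛ C ≈ₛ const (+ 1) -ₛ S) where

    S-suc : ∀ k → S (suc k) ≡ -[1+ 1 ] * C k
    S-suc k = begin
      S (suc k)              ≡⟨ negate-twice (S (suc k)) ⟩
      - (+ 0 - S (suc k))    ≡⟨ cong -_ (trans (sym (cz-*ₛ-suc (+ 2) C k)) (2zC≈1-S (suc k))) ⟨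
      - (+ 2 * C k)          ≡⟨ ℤ.neg-distribˡ-* (+ 2) (C k) ⟩
      -[1+ 1 ] * C k         ∎
      where
      negate-twice : ∀ s → s ≡ - (+ 0 - s)
      negate-twice = solve-∀

    S∘suc≈-2C : S ∘ suc ≈ₛ const -[1+ 1 ] *ₛ C
    S∘suc≈-2C k = trans (S-suc k) (sym (const-*ₛ -[1+ 1 ] C k))

    C-zero : C 0 ≡ + 1
    C-zero = ℤ.*-cancelˡ-≡ (+ 4) (C 0) (+ 1) (ℤ.neg-injective (begin
      - (+ 4 * C 0)                            ≡⟨ two-terms (C 0) ⟩
      + 1 * (-[1+ 1 ] * C 0) + -[1+ 1 ] * C 0 * + 1
        ≡⟨ cong₂ _+_ (cong₂ _*_ S₀≡1 (S-suc 0)) (cong₂ _*_ (S-suc 0) S₀≡1) ⟨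
      S 0 * S 1 + S 1 * S 0                    ≡⟨ cong (_+_ (S 0 * S 1)) (*ₛ-zero-index (S ∘ suc) S) ⟨
      S 0 * S 1 + (S ∘ suc *ₛ S) 0             ≡⟨ *ₛ-suc S S 0 ⟨
      (S *ₛ S) 1                               ≡⟨ S²≈1-4z 1 ⟩
      - (+ 4 * + 1)                            ∎))
      where
      two-terms : ∀ c → - (+ 4 * c) ≡ + 1 * (-[1+ 1 ] * c) + -[1+ 1 ] * c * + 1
      two-terms = solve-∀

    S∘suc-squared : ∀ n → (S ∘ suc *ₛ S ∘ suc) n ≡ + 4 * (C *ₛ C) n
    S∘suc-squared n = begin
      (S ∘ suc *ₛ S ∘ suc) n             ≡⟨ (S∘suc≈-2C ⟨*⟩ S∘suc≈-2C) n ⟩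
      (−2 *ₛ C *ₛ (−2 *ₛ C)) n
        ≡⟨ solve 2 (λ a c → a :* c :* (a :* c) := a :* a :* (c :* c)) ≈ₛ-refl −2 C n ⟩
      (−2 *ₛ −2 *ₛ (C *ₛ C)) n           ≡⟨ (−2*ₛ−2≈4 ⟨*⟩ ≈ₛ-refl {C *ₛ C}) n ⟩
      (const (+ 4) *ₛ (C *ₛ C)) n        ≡⟨ const-*ₛ (+ 4) (C *ₛ C) n ⟩
      + 4 * (C *ₛ C) n                   ∎
      where
      −2 : Series
      −2 = const -[1+ 1 ]
      −2*ₛ−2≈4 : −2 *ₛ −2 ≈ₛ const (+ 4)
      −2*ₛ−2≈4 zero    = *ₛ-zero-index −2 −2
      −2*ₛ−2≈4 (suc n) = const-*ₛ -[1+ 1 ] −2 (suc n)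

    C-suc : ∀ n → C (suc n) ≡ (C *ₛ C) n
    C-suc n = ℤ.*-cancelˡ-≡ (+ 4) (C (suc n)) ((C *ₛ C) n) (begin
      + 4 * c                                                            ≡⟨ ℤ.+-identityʳ (+ 4 * c) ⟨
      + 4 * c + + 0                                                      ≡⟨ cong (_+_ (+ 4 * c)) coefficient ⟩
      + 4 * c + (+ 1 * (-[1+ 1 ] * c) + (+ 1 * (-[1+ 1 ] * c) + + 4 * y)) ≡⟨ cancel c y ⟩
      + 4 * y                                                            ∎)
      where
      c = C (suc n)
      y = (C *ₛ C) n
      cancel : ∀ c y → + 4 * c + (+ 1 * (-[1+ 1 ] * c) + (+ 1 * (-[1+ 1 ] * c) + + 4 * y)) ≡ + 4 * y
      cancel = solve-∀
      coefficient : + 0 ≡ + 1 * (-[1+ 1 ] * c) + (+ 1 * (-[1+ 1 ] * c) + + 4 * y)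
      coefficient = begin
        + 0                                                       ≡⟨ S²≈1-4z (suc (suc n)) ⟨
        (S *ₛ S) (suc (suc n))                                    ≡⟨ *ₛ-suc S S (suc n) ⟩
        S 0 * S (suc (suc n)) + (S ∘ suc *ₛ S) (suc n)
          ≡⟨ cong (_+_ (S 0 * S (suc (suc n)))) (*ₛ-comm (S ∘ suc) S (suc n)) ⟩
        S 0 * S (suc (suc n)) + (S *ₛ S ∘ suc) (suc n)
          ≡⟨ cong (_+_ (S 0 * S (suc (suc n)))) (*ₛ-suc S (S ∘ suc) n) ⟩
        S 0 * S (suc (suc n)) + (S 0 * S (suc (suc n)) + (S ∘ suc *ₛ S ∘ suc) n)
          ≡⟨ cong₂ _+_ (cong₂ _*_ S₀≡1 (S-suc (suc n)))
                       (cong₂ _+_ (cong₂ _*_ S₀≡1 (S-suc (suc n))) (S∘suc-squared n)) ⟩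
        + 1 * (-[1+ 1 ] * c) + (+ 1 * (-[1+ 1 ] * c) + + 4 * y)    ∎

    catalan-equation : C ≈ₛ 𝟙 +ₛ Z *ₛ (C *ₛ C)
    catalan-equation zero    = trans C-zero (sym (cong (_+_ (+ 1)) (Z*ₛ-zero (C *ₛ C))))
    catalan-equation (suc n) = trans (C-suc n) (sym (trans (ℤ.+-identityˡ _) (Z*ₛ-suc (C *ₛ C) n)))

    B-zero : B 0 ≡ + 1
    B-zero = begin
      B 0           ≡⟨ ℤ.*-identityʳ (B 0) ⟨
      B 0 * + 1     ≡⟨ cong (B 0 *_) S₀≡1 ⟨
      B 0 * S 0     ≡⟨ *ₛ-zero-index B S ⟨
      (B *ₛ S) 0    ≡⟨ B*S≈1 0 ⟩
      + 1           ∎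

    B-suc : ∀ n → B (suc n) ≡ (B *ₛ C +ₛ B *ₛ C) n
    B-suc n = begin
      B (suc n)                                   ≡⟨ rearrange (B (suc n)) x ⟩
      + 1 * B (suc n) + -[1+ 1 ] * x + (x + x)    ≡⟨ cong (_+ (x + x)) coefficient ⟨
      + 0 + (x + x)                               ≡⟨ ℤ.+-identityˡ (x + x) ⟩
      x + x                                       ≡⟨ cong₂ _+_ (*ₛ-comm C B n) (*ₛ-comm C B n) ⟩
      (B *ₛ C +ₛ B *ₛ C) n                        ∎
      where
      x = (C *ₛ B) n
      rearrange : ∀ b x → b ≡ + 1 * b + -[1+ 1 ] * x + (x + x)
      rearrange = solve-∀
      coefficient : + 0 ≡ + 1 * B (suc n) + -[1+ 1 ] * x
      coefficient = begin
        + 0                                         ≡⟨ B*S≈1 (suc n) ⟨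
        (B *ₛ S) (suc n)                            ≡⟨ *ₛ-comm B S (suc n) ⟩
        (S *ₛ B) (suc n)                            ≡⟨ *ₛ-suc S B n ⟩
        S 0 * B (suc n) + (S ∘ suc *ₛ B) n
          ≡⟨ cong₂ _+_ (cong (_* B (suc n)) S₀≡1) ((S∘suc≈-2C ⟨*⟩ ≈ₛ-refl {B}) n) ⟩
        + 1 * B (suc n) + (const -[1+ 1 ] *ₛ C *ₛ B) n
          ≡⟨ cong (_+_ (+ 1 * B (suc n))) (trans (*ₛ-assoc (const -[1+ 1 ]) C B n) (const-*ₛ -[1+ 1 ] (C *ₛ B) n)) ⟩
        + 1 * B (suc n) + -[1+ 1 ] * x              ∎

    B-equation : B ≈ₛ 𝟙 +ₛ Z *ₛ (B *ₛ C +ₛ B *ₛ C)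
    B-equation zero    = trans B-zero (sym (cong (_+_ (+ 1)) (Z*ₛ-zero (B *ₛ C +ₛ B *ₛ C))))
    B-equation (suc n) = trans (B-suc n) (sym (trans (ℤ.+-identityˡ _) (Z*ₛ-suc (B *ₛ C +ₛ B *ₛ C) n)))


module Avoiders where

  open import Defs
  open import Data.Bool using (true; false; not; T; T?)
  open import Data.Bool.Properties using (T-∧)
  open import Data.List using (List; []; _∷_; map; upTo; length)
  open import Data.List.Properties using (map-applyUpTo; ∷-injectiveʳ)
  open import Data.List.Membership.Propositional using (_∈_; find; lose)
  open import Data.List.Membership.Propositional.Properties
    using (∈-map⁺; ∈-map⁻; ∈-concatMap⁺; ∈-concatMap⁻; ∈-upTo⁺; ∈-upTo⁻; ∈-filter⁺; ∈-filter⁻)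
  open import Data.List.Relation.Binary.Disjoint.Propositional using (Disjoint)
  open import Data.List.Relation.Unary.All as All using (All; []; _∷_)
  open import Data.List.Relation.Unary.All.Properties using (all⁺; all⁻)
  open import Data.List.Relation.Unary.AllPairs using (AllPairs)
  import Data.List.Relation.Unary.AllPairs.Properties as AllPairs
  open import Data.List.Relation.Unary.Any using (here)
  open import Data.List.Relation.Unary.Unique.Propositional using (Unique; []; _∷_)
  import Data.List.Relation.Unary.Unique.Propositional.Properties as Unique
  open import Data.Nat using (ℕ; zero; suc; _<_; _≡ᵇ_)
  open import Data.Nat.Properties using (≡ᵇ⇒≡; ≡⇒≡ᵇ; <⇒≢)
  open import Data.Product using (_×_; _,_)
  open import Function using (_∘_; id; Equivalence)
  open import Relation.Nullary using (¬_)
  open import Relation.Binary.PropositionalEquality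

  ∈-words⁻ : ∀ k m {xs} → xs ∈ words k m → length xs ≡ k × All (_< m) xs
  ∈-words⁻ zero    m (here refl) = refl , []
  ∈-words⁻ (suc k) m xs∈ with find (∈-concatMap⁻ (λ x → map (x ∷_) (words k m)) {xs = upTo m} xs∈)
  ... | x , x∈ , x∷ys∈ with ∈-map⁻ (x ∷_) x∷ys∈
  ... | ys , ys∈ , refl with ∈-words⁻ k m ys∈
  ... | length≡ , bounded = cong suc length≡ , ∈-upTo⁻ x∈ ∷ bounded

  ∈-words⁺ : ∀ k m {xs} → length xs ≡ k → All (_< m) xs → xs ∈ words k m
  ∈-words⁺ zero    m {[]}     refl []            = here refl
  ∈-words⁺ (suc k) m {x ∷ xs} refl (x<m ∷ xs<m) =
    ∈-concatMap⁺ (λ x → map (x ∷_) (words k m)) (lose (∈-upTo⁺ x<m) (∈-map⁺ (x ∷_) (∈-words⁺ k m refl xs<m)))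

  words-unique : ∀ k m → Unique (words k m)
  words-unique zero    m = [] ∷ []
  words-unique (suc k) m = Unique.concat⁺ (blocks-unique (upTo m))
    (subst (AllPairs Disjoint) (sym (map-applyUpTo id block m)) (AllPairs.applyUpTo⁺₁ block m disjoint))
    where
    block : ℕ → List (List ℕ)
    block x = map (x ∷_) (words k m)
    blocks-unique : ∀ xs → All Unique (map block xs)
    blocks-unique []       = []
    blocks-unique (x ∷ xs) = Unique.map⁺ ∷-injectiveʳ (words-unique k m) ∷ blocks-unique xs
    disjoint : ∀ {i j} → i < j → j < m → Disjoint (block i) (block j)
    disjoint {i} {j} i<j _ (p , q) with ∈-map⁻ (i ∷_) p | ∈-map⁻ (j ∷_) q
    ... | _ , _ , refl | _ , _ , i∷ys≡j∷zs = <⇒≢ i<j (cong (λ { [] → 0 ; (h ∷ _) → h }) i∷ys≡j∷zs)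

  distinct⇒Unique : ∀ xs → T (distinct xs) → Unique xs
  distinct⇒Unique []       _ = []
  distinct⇒Unique (x ∷ xs) t with Equivalence.to T-∧ t
  ... | fresh , rest = All.map x≢ (all⁺ _ xs fresh) ∷ distinct⇒Unique xs rest
    where
    x≢ : ∀ {y} → T (not (x ≡ᵇ y)) → x ≢ y
    x≢ {y} t x≡y with x ≡ᵇ y | ≡⇒≡ᵇ x y x≡y
    x≢ () x≡y | true | _

  Unique⇒distinct : ∀ xs → Unique xs → T (distinct xs)
  Unique⇒distinct []       _ = _
  Unique⇒distinct (x ∷ xs) (x∉ ∷ u) = Equivalence.from T-∧ (all⁻ _ (All.map x≢ x∉) , Unique⇒distinct xs u)
    where
    x≢ : ∀ {y} → x ≢ y → T (not (x ≡ᵇ y))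
    x≢ {y} x≢y with x ≡ᵇ y in eq
    ... | true  = x≢y (≡ᵇ⇒≡ x y (subst T (sym eq) _))
    ... | false = _

  record IsAvoider (n : ℕ) (π : List ℕ) : Set where
    constructor avoider
    field
      length≡ : length π ≡ n
      bounded : All (_< n) π
      unique  : Unique π
      avoids  : ¬ T (contains231 π)

  ∈-avoiders231⁻ : ∀ n {π} → π ∈ avoiders231 n → IsAvoider n π
  ∈-avoiders231⁻ n {π} π∈ with ∈-filter⁻ (T? ∘ (not ∘ contains231)) π∈
  ... | π∈perms , t with ∈-filter⁻ (T? ∘ distinct) π∈perms
  ... | π∈words , d with ∈-words⁻ n n π∈words
  ... | length≡ , bounded = avoider length≡ bounded (distinct⇒Unique π d) (not-T t)
    where
    not-T : ∀ {b} → T (not b) → ¬ T b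
    not-T {true} ()

  ∈-avoiders231⁺ : ∀ n {π} → IsAvoider n π → π ∈ avoiders231 n
  ∈-avoiders231⁺ n {π} (avoider length≡ bounded unique avoids) =
    ∈-filter⁺ (T? ∘ (not ∘ contains231))
      (∈-filter⁺ (T? ∘ distinct) (∈-words⁺ n n length≡ bounded) (Unique⇒distinct π unique))
      (T-not avoids)
    where
    T-not : ∀ {b} → ¬ T b → T (not b)
    T-not {true}  ¬t = ¬t _
    T-not {false} _  = _

  avoiders231-unique : ∀ n → Unique (avoiders231 n)
  avoiders231-unique n = Unique.filter⁺ (T? ∘ (not ∘ contains231)) (Unique.filter⁺ (T? ∘ distinct) (words-unique n n))


module Pattern231 where

  open import Defs
  open import Data.Bool using (_∧_; _∨_; T)
  open import Data.Bool.ListAction using (any)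
  open import Data.Bool.Properties using (T-∨; T-∧)
  open import Data.Empty using (⊥-elim)
  open import Data.List using ([]; _∷_; map; length; _++_)
  open import Data.List.Properties using (length-map)
  open import Data.List.Membership.Propositional using (_∈_)
  open import Data.List.Relation.Unary.All as All using (All; []; _∷_)
  import Data.List.Relation.Unary.All.Properties as All
  open import Data.List.Relation.Unary.Any as Any using (Any; here; there)
  open import Data.List.Relation.Unary.Any.Properties using (any⁺; any⁻; ++⁺ˡ; ++⁻)
  open import Data.List.Relation.Unary.Unique.Propositional using (Unique; []; _∷_)
  open import Data.Nat using (ℕ; zero; suc; _≤_; _<_; _<ᵇ_; z≤n; s≤s; s≤s⁻¹; _∸_; _+_; _≟_)
  open import Data.Nat.Properties
  open import Data.Product using (_×_; _,_; proj₁; proj₂)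
  open import Data.Sum using (_⊎_; inj₁; inj₂)
  open import Function using (_∘_; Equivalence)
  open import Relation.Nullary using (¬_; yes; no)
  open import Relation.Binary.PropositionalEquality

  Unique-map⁺ : ∀ {A B : Set} (f : A → B) {xs} → Unique xs
    → (∀ {x y} → x ∈ xs → y ∈ xs → f x ≡ f y → x ≡ y) → Unique (map f xs)
  Unique-map⁺ f {[]}     _          _   = []
  Unique-map⁺ f {x ∷ xs} (x∉ ∷ u) inj =
    All.map⁺ (All.tabulate (λ {y} y∈ fx≡fy → All.lookup x∉ y∈ (inj (here refl) (there y∈) fx≡fy)))
    ∷ Unique-map⁺ f u (λ p q → inj (there p) (there q))

  -- Pigeonhole, by induction: rename the entry m of the tail (if any) to the head, then drop the head.
  Unique-length-≤ : ∀ m {xs} → Unique xs → All (_< m) xs → length xs ≤ m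
  Unique-length-≤ m       {[]}     _          _             = z≤n
  Unique-length-≤ (suc m) {x ∷ xs} (x∉ ∷ u) (x<m ∷ xs<m) =
    s≤s (subst (_≤ m) (length-map rename xs)
      (Unique-length-≤ m (Unique-map⁺ rename u injective) (All.map⁺ (All.tabulate bound))))
    where
    rename : ℕ → ℕ
    rename y with y ≟ m
    ... | yes _ = x
    ... | no  _ = y
    bound : ∀ {y} → y ∈ xs → rename y < m
    bound {y} y∈ with y ≟ m
    ... | yes refl = ≤∧≢⇒< (s≤s⁻¹ x<m) (All.lookup x∉ y∈)
    ... | no  y≢m  = ≤∧≢⇒< (s≤s⁻¹ (All.lookup xs<m y∈)) y≢m
    injective : ∀ {y z} → y ∈ xs → z ∈ xs → rename y ≡ rename z → y ≡ z
    injective {y} {z} p q e with y ≟ m | z ≟ m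
    ... | yes y≡m | yes z≡m = trans y≡m (sym z≡m)
    ... | yes _   | no  _   = ⊥-elim (All.lookup x∉ q e)
    ... | no  _   | yes _   = ⊥-elim (All.lookup x∉ p (sym e))
    ... | no  _   | no  _   = e

  Unique-length-≤-interval : ∀ lo hi {xs} → Unique xs → All (λ y → lo ≤ y × y < hi) xs → length xs ≤ hi ∸ lo
  Unique-length-≤-interval lo hi {xs} u bounded = subst (_≤ hi ∸ lo) (length-map (_∸ lo) xs)
    (Unique-length-≤ (hi ∸ lo)
      (Unique-map⁺ (_∸ lo) u (λ p q → ∸-cancelʳ-≡ (proj₁ (All.lookup bounded p)) (proj₁ (All.lookup bounded q))))
      (All.map⁺ (All.map (λ (lo≤y , y<hi) → ∸-monoˡ-< y<hi lo≤y) bounded)))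

  private
    ∨-introˡ : ∀ {x y} → T x → T (x ∨ y)
    ∨-introˡ t = Equivalence.from T-∨ (inj₁ t)

    ∨-introʳ : ∀ {x y} → T y → T (x ∨ y)
    ∨-introʳ t = Equivalence.from T-∨ (inj₂ t)

    ∨-elim : ∀ {x y} → T (x ∨ y) → T x ⊎ T y
    ∨-elim = Equivalence.to T-∨

    ∧-intro : ∀ {x y} → T x → T y → T (x ∧ y)
    ∧-intro s t = Equivalence.from T-∧ (s , t)

    ∧-elim : ∀ {x y} → T (x ∧ y) → T x × T y
    ∧-elim = Equivalence.to T-∧

    none-below : ∀ a {cs} → All (a <_) cs → ¬ T (any (_<ᵇ a) cs)
    none-below a a<cs t =
      All.All¬⇒¬Any (All.map (λ {c} a<c c<a → <-asym a<c (<ᵇ⇒< c a c<a)) a<cs) (any⁻ (_<ᵇ a) _ t)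

  231-from-++ˡ : ∀ a xs ys → T (231-from a xs) → T (231-from a (xs ++ ys))
  231-from-++ˡ a (b ∷ xs) ys t with ∨-elim {(a <ᵇ b) ∧ any (_<ᵇ a) xs} t
  ... | inj₁ t' with ∧-elim {a <ᵇ b} t'
  ...   | a<b , c<a = ∨-introˡ (∧-intro a<b (any⁺ (_<ᵇ a) (++⁺ˡ (any⁻ (_<ᵇ a) xs c<a))))
  231-from-++ˡ a (b ∷ xs) ys t | inj₂ t' = ∨-introʳ {(a <ᵇ b) ∧ any (_<ᵇ a) (xs ++ ys)} (231-from-++ˡ a xs ys t')

  contains231-++ˡ : ∀ xs ys → T (contains231 xs) → T (contains231 (xs ++ ys))
  contains231-++ˡ (a ∷ xs) ys t with ∨-elim {231-from a xs} t
  ... | inj₁ t' = ∨-introˡ (231-from-++ˡ a xs ys t')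
  ... | inj₂ t' = ∨-introʳ {231-from a (xs ++ ys)} (contains231-++ˡ xs ys t')

  contains231-++ʳ : ∀ xs ys → T (contains231 ys) → T (contains231 (xs ++ ys))
  contains231-++ʳ []       ys t = t
  contains231-++ʳ (x ∷ xs) ys t = ∨-introʳ {231-from x (xs ++ ys)} (contains231-++ʳ xs ys t)

  <ᵇ-+ˡ : ∀ k a b → ((k + a) <ᵇ (k + b)) ≡ (a <ᵇ b)
  <ᵇ-+ˡ zero    a b = refl
  <ᵇ-+ˡ (suc k) a b = <ᵇ-+ˡ k a b

  231-from-shift : ∀ k a cs → 231-from (k + a) (map (k +_) cs) ≡ 231-from a cs
  231-from-shift k a []       = refl
  231-from-shift k a (b ∷ cs) = cong₂ _∨_ (cong₂ _∧_ (<ᵇ-+ˡ k a b) (any-shift cs)) (231-from-shift k a cs)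
    where
    any-shift : ∀ cs → any (_<ᵇ (k + a)) (map (k +_) cs) ≡ any (_<ᵇ a) cs
    any-shift []       = refl
    any-shift (c ∷ cs) = cong₂ _∨_ (<ᵇ-+ˡ k c a) (any-shift cs)

  contains231-shift : ∀ k xs → contains231 (map (k +_) xs) ≡ contains231 xs
  contains231-shift k []       = refl
  contains231-shift k (a ∷ xs) = cong₂ _∨_ (231-from-shift k a xs) (contains231-shift k xs)

  231-from-above : ∀ a {ys} → All (a <_) ys → ¬ T (231-from a ys)
  231-from-above a {b ∷ cs} (_ ∷ a<cs) t with ∨-elim {(a <ᵇ b) ∧ any (_<ᵇ a) cs} t
  ... | inj₁ t' = none-below a a<cs (proj₂ (∧-elim {a <ᵇ b} t'))
  ... | inj₂ t' = 231-from-above a a<cs t'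

  231-from-++-above : ∀ a xs {ys} → All (a <_) ys → T (231-from a (xs ++ ys)) → T (231-from a xs)
  231-from-++-above a []       a<ys t = ⊥-elim (231-from-above a a<ys t)
  231-from-++-above a (b ∷ xs) {ys} a<ys t with ∨-elim {(a <ᵇ b) ∧ any (_<ᵇ a) (xs ++ ys)} t
  ... | inj₂ t' = ∨-introʳ {(a <ᵇ b) ∧ any (_<ᵇ a) xs} (231-from-++-above a xs a<ys t')
  ... | inj₁ t' with ∧-elim {a <ᵇ b} t'
  ...   | a<b , c<a with ++⁻ xs (any⁻ (_<ᵇ a) (xs ++ ys) c<a)
  ...     | inj₁ in-xs = ∨-introˡ (∧-intro a<b (any⁺ (_<ᵇ a) in-xs))
  ...     | inj₂ in-ys = ⊥-elim (none-below a a<ys (any⁺ (_<ᵇ a) in-ys))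

  231-from-max : ∀ n {bs} → All (_< n) bs → ¬ T (231-from n bs)
  231-from-max n {b ∷ cs} (b<n ∷ cs<n) t with ∨-elim {(n <ᵇ b) ∧ any (_<ᵇ n) cs} t
  ... | inj₁ t' = <-asym b<n (<ᵇ⇒< n b (proj₁ (∧-elim {n <ᵇ b} t')))
  ... | inj₂ t' = 231-from-max n cs<n t'

  -- The 1 of an occurrence of 2-3-1 in α n γ follows its 2 and is smaller, so, as α lies below γ,
  -- both lie on one side of n; and n, being maximal, could only be the 3, which would separate them.
  insert-max-avoids : ∀ n α γ → All (_< n) α → All (_< n) γ → All (λ a → All (a <_) γ) α
    → ¬ T (contains231 α) → ¬ T (contains231 γ) → ¬ T (contains231 (α ++ n ∷ γ))
  insert-max-avoids n []      γ _ γ<n _ _ γ-avoids t with ∨-elim {231-from n γ} t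
  ... | inj₁ t' = 231-from-max n γ<n t'
  ... | inj₂ t' = γ-avoids t'
  insert-max-avoids n (a ∷ α) γ (a<n ∷ α<n) γ<n (a<γ ∷ α<γ) aα-avoids γ-avoids t with ∨-elim {231-from a (α ++ n ∷ γ)} t
  ... | inj₁ t' = aα-avoids (∨-introˡ (231-from-++-above a α (a<n ∷ a<γ) t'))
  ... | inj₂ t' = insert-max-avoids n α γ α<n γ<n α<γ (aα-avoids ∘ ∨-introʳ {231-from a α}) γ-avoids t'

  231-from-witness : ∀ a b c xs ys → a < b → c ∈ ys → c < a → T (231-from a (xs ++ b ∷ ys))
  231-from-witness a b c []       ys a<b c∈ c<a =
    ∨-introˡ (∧-intro (<⇒<ᵇ a<b) (any⁺ (_<ᵇ a) (Any.map (λ { refl → <⇒<ᵇ c<a }) c∈)))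
  231-from-witness a b c (x ∷ xs) ys a<b c∈ c<a =
    ∨-introʳ {(a <ᵇ x) ∧ any (_<ᵇ a) (xs ++ b ∷ ys)} (231-from-witness a b c xs ys a<b c∈ c<a)

  contains231-witness : ∀ n {a c} α γ → a ∈ α → c ∈ γ → c < a → a < n → T (contains231 (α ++ n ∷ γ))
  contains231-witness n (x ∷ α) γ (here refl) c∈ c<a a<n = ∨-introˡ (231-from-witness x n _ α γ a<n c∈ c<a)
  contains231-witness n (x ∷ α) γ (there a∈) c∈ c<a a<n =
    ∨-introʳ {231-from x (α ++ n ∷ γ)} (contains231-witness n α γ a∈ c∈ c<a a<n)


module Decomposition where

  open import Defs
  open Avoiders
  open Pattern231
  open import Data.Bool using (T)
  open import Data.Empty using (⊥; ⊥-elim)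
  open import Data.List using (List; []; _∷_; map; length; _++_; concatMap; cartesianProduct; upTo)
  open import Data.List.Properties using (length-map; length-++; map-applyUpTo; map-injective; ∷-injective)
  open import Data.List.Membership.Propositional using (_∈_; find; lose)
  open import Data.List.Membership.Propositional.Properties
    using (∈-∃++; ∈-map⁺; ∈-map⁻; ∈-concatMap⁺; ∈-concatMap⁻; ∈-upTo⁺; ∈-upTo⁻; ∈-cartesianProduct⁺; ∈-cartesianProduct⁻)
  open import Data.List.Membership.Propositional.Properties.WithK using (unique∧set⇒bag)
  open import Data.List.Relation.Binary.BagAndSetEquality using (∼bag⇒↭)
  open import Data.List.Relation.Binary.Disjoint.Propositional using (Disjoint)
  open import Data.List.Relation.Binary.Permutation.Propositional using (_↭_)
  open import Data.List.Relation.Unary.AllPairs using (AllPairs)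
  import Data.List.Relation.Unary.AllPairs.Properties as AllPairs
  open import Data.List.Relation.Unary.All as All using (All; []; _∷_)
  import Data.List.Relation.Unary.All.Properties as All
  open import Data.List.Relation.Unary.Any using (here; there)
  open import Data.List.Relation.Unary.Unique.Propositional using (Unique; []; _∷_)
  import Data.List.Relation.Unary.Unique.Propositional.Properties as Unique
  open import Data.Nat using (ℕ; suc; _≤_; _<_; s≤s; s≤s⁻¹; _∸_; _+_; _≟_; _<?_; _≤?_)
  open import Data.List.Membership.DecPropositional _≟_ using (_∈?_)
  open import Data.Nat.Properties
  open import Data.Product using (_×_; _,_; proj₁; proj₂; ∃-syntax)
  open import Function using (_∘_; id; _⇔_; mk⇔)
  open import Relation.Nullary using (¬_; yes; no)
  open import Relation.Binary.PropositionalEquality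
  open ≡-Reasoning

  glue : ℕ → ℕ → List ℕ → List ℕ → List ℕ
  glue n k α β = α ++ n ∷ map (k +_) β

  glue-avoider : ∀ {n k α β} → k ≤ n → IsAvoider k α → IsAvoider (n ∸ k) β → IsAvoider (suc n) (glue n k α β)
  glue-avoider {n} {k} {α} {β} k≤n (avoider refl α<k α-unique α-avoids) (avoider β-length β<n-k β-unique β-avoids) =
    avoider length≡ bounded unique avoids
    where
    γ = map (k +_) β
    γ<n : All (_< n) γ
    γ<n = All.map⁺ (All.map (λ {b} b<n-k → subst (k + b <_) (m+[n∸m]≡n k≤n) (+-monoʳ-< k b<n-k)) β<n-k)
    k≤γ : All (k ≤_) γ
    k≤γ = All.map⁺ (All.tabulate (λ {b} _ → m≤m+n k b))
    α<n : All (_< n) α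
    α<n = All.map (λ a<k → ≤-trans a<k k≤n) α<k
    length≡ : length (glue n k α β) ≡ suc n
    length≡ = begin
      length (α ++ n ∷ γ)        ≡⟨ length-++ α ⟩
      k + suc (length γ)         ≡⟨ cong (λ l → k + suc l) (trans (length-map (k +_) β) β-length) ⟩
      k + suc (n ∸ k)            ≡⟨ +-suc k (n ∸ k) ⟩
      suc (k + (n ∸ k))          ≡⟨ cong suc (m+[n∸m]≡n k≤n) ⟩
      suc n                      ∎
    bounded : All (_< suc n) (glue n k α β)
    bounded = All.++⁺ (All.map m<n⇒m<1+n α<n) (n<1+n n ∷ All.map m<n⇒m<1+n γ<n)
    unique : Unique (glue n k α β)
    unique = Unique.++⁺ α-unique
      (All.map (λ c<n n≡c → <-irrefl (sym n≡c) c<n) γ<n ∷ Unique.map⁺ (+-cancelˡ-≡ k _ _) β-unique)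
      (λ (p , q) → <-irrefl refl (≤-trans (All.lookup α<k p) (All.lookup (k≤n ∷ k≤γ) q)))
    avoids : ¬ T (contains231 (glue n k α β))
    avoids = insert-max-avoids n α γ α<n γ<n (All.map (λ a<k → All.map (<-≤-trans a<k) k≤γ) α<k) α-avoids
      (β-avoids ∘ subst T (contains231-shift k β))

  max-∈ : ∀ {n π} → IsAvoider (suc n) π → n ∈ π
  max-∈ {n} {π} (avoider π-length π<1+n π-unique _) with n ∈? π
  ... | yes n∈π = n∈π
  ... | no  n∉π = ⊥-elim (<-irrefl refl (≤-trans (≤-reflexive (sym π-length))
    (Unique-length-≤ n π-unique (All.tabulate λ {y} y∈π →
      ≤∧≢⇒< (s≤s⁻¹ (All.lookup π<1+n y∈π)) (λ y≡n → n∉π (subst (_∈ π) y≡n y∈π))))))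

  Unique-++⁻ : ∀ (xs : List ℕ) {ys} → Unique (xs ++ ys) → Unique xs × Unique ys × (∀ {v} → v ∈ xs → v ∈ ys → ⊥)
  Unique-++⁻ []       u = [] , u , λ ()
  Unique-++⁻ (x ∷ xs) (x∉ ∷ u) with Unique-++⁻ xs u
  ... | xs-unique , ys-unique , disjoint =
    All.++⁻ˡ xs x∉ ∷ xs-unique , ys-unique ,
    λ { (here refl) q → All.lookup (All.++⁻ʳ xs x∉) q refl ; (there p) q → disjoint p q }

  shift-unshift : ∀ k {γ} → All (k ≤_) γ → map (k +_) (map (_∸ k) γ) ≡ γ
  shift-unshift k []           = refl
  shift-unshift k (k≤c ∷ k≤γ) = cong₂ _∷_ (m+[n∸m]≡n k≤c) (shift-unshift k k≤γ)

  module MaxSplit {n} (α γ : List ℕ) (av : IsAvoider (suc n) (α ++ n ∷ γ)) where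

    open IsAvoider av

    private
      k = length α
      parts = Unique-++⁻ α unique

    α-unique : Unique α
    α-unique = proj₁ parts

    γ-unique : Unique γ
    γ-unique with proj₁ (proj₂ parts)
    ... | _ ∷ u = u

    n∉γ : All (n ≢_) γ
    n∉γ with proj₁ (proj₂ parts)
    ... | n∉ ∷ _ = n∉

    α∩nγ=∅ : ∀ {v} → v ∈ α → v ∈ n ∷ γ → ⊥
    α∩nγ=∅ = proj₂ (proj₂ parts)

    α<n : All (_< n) α
    α<n = All.tabulate λ {a} a∈α →
      ≤∧≢⇒< (s≤s⁻¹ (All.lookup (All.++⁻ˡ α bounded) a∈α)) (λ a≡n → α∩nγ=∅ a∈α (here a≡n))

    γ<n : All (_< n) γ
    γ<n with All.++⁻ʳ α bounded
    ... | _ ∷ γ<1+n = All.tabulate λ {c} c∈γ →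
      ≤∧≢⇒< (s≤s⁻¹ (All.lookup γ<1+n c∈γ)) (λ c≡n → All.lookup n∉γ c∈γ (sym c≡n))

    α<γ : ∀ {a c} → a ∈ α → c ∈ γ → a < c
    α<γ {a} {c} a∈α c∈γ with a <? c
    ... | yes a<c = a<c
    ... | no  a≮c = ⊥-elim (avoids (contains231-witness n α γ a∈α c∈γ c<a (All.lookup α<n a∈α)))
      where
      c<a : c < a
      c<a = ≤∧≢⇒< (≮⇒≥ a≮c) (λ c≡a → α∩nγ=∅ a∈α (there (subst (_∈ γ) c≡a c∈γ)))

    k+|γ|≡n : k + length γ ≡ n
    k+|γ|≡n = suc-injective (trans (sym (+-suc k (length γ))) (trans (sym (length-++ α)) length≡))

    k≤n : k ≤ n
    k≤n = subst (k ≤_) k+|γ|≡n (m≤m+n k (length γ))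

    |γ|≡n∸k : length γ ≡ n ∸ k
    |γ|≡n∸k = trans (sym (m+n∸m≡n k (length γ))) (cong (_∸ k) k+|γ|≡n)

    -- An entry a ≥ k of α would give length γ + 1 distinct values in [k, n).
    α<k : All (_< k) α
    α<k = All.tabulate λ {a} a∈α → case-a a∈α (a <? k)
      where
      case-a : ∀ {a} → a ∈ α → Relation.Nullary.Dec (a < k) → a < k
      case-a _ (yes a<k) = a<k
      case-a {a} a∈α (no a≮k) = ⊥-elim (<-irrefl refl (≤-trans (≤-reflexive (cong suc (sym |γ|≡n∸k)))
        (Unique-length-≤-interval k n
          (All.tabulate (λ c∈γ a≡c → α∩nγ=∅ a∈α (there (subst (_∈ γ) (sym a≡c) c∈γ))) ∷ γ-unique)
          ((≮⇒≥ a≮k , All.lookup α<n a∈α)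
            ∷ All.tabulate (λ {c} c∈γ → ≤-trans (≮⇒≥ a≮k) (<⇒≤ (α<γ a∈α c∈γ)) , All.lookup γ<n c∈γ)))))

    -- An entry c < k of γ would give k + 1 distinct values in [0, c].
    k≤γ : All (k ≤_) γ
    k≤γ = All.tabulate λ {c} c∈γ → case-c c∈γ (k ≤? c)
      where
      case-c : ∀ {c} → c ∈ γ → Relation.Nullary.Dec (k ≤ c) → k ≤ c
      case-c _ (yes k≤c) = k≤c
      case-c {c} c∈γ (no k≰c) = ⊥-elim (k≰c (s≤s⁻¹ (Unique-length-≤ (suc c)
        (All.tabulate (λ a∈α c≡a → α∩nγ=∅ (subst (_∈ α) (sym c≡a) a∈α) (there c∈γ)) ∷ α-unique)
        (n<1+n c ∷ All.tabulate (λ a∈α → m<n⇒m<1+n (α<γ a∈α c∈γ))))))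

    left-avoider : IsAvoider k α
    left-avoider = avoider refl α<k α-unique (avoids ∘ contains231-++ˡ α (n ∷ γ))

    right-avoider : IsAvoider (n ∸ k) (map (_∸ k) γ)
    right-avoider = avoider
      (trans (length-map (_∸ k) γ) |γ|≡n∸k)
      (All.map⁺ (All.tabulate (λ {c} c∈γ → ∸-monoˡ-< (All.lookup γ<n c∈γ) (All.lookup k≤γ c∈γ))))
      (Unique-map⁺ (_∸ k) γ-unique (λ p q → ∸-cancelʳ-≡ (All.lookup k≤γ p) (All.lookup k≤γ q)))
      (avoids ∘ contains231-++ʳ α (n ∷ γ) ∘ contains231-++ʳ (n ∷ []) γ ∘ subst (T ∘ contains231) (shift-unshift k k≤γ)
              ∘ subst T (sym (contains231-shift k (map (_∸ k) γ))))

    glue-decomposition : α ++ n ∷ γ ≡ glue n k α (map (_∸ k) γ)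
    glue-decomposition = cong (λ γ' → α ++ n ∷ γ') (sym (shift-unshift k k≤γ))

  record MaxDecomposition (n : ℕ) (π : List ℕ) : Set where
    field
      left right    : List ℕ
      length≤       : length left ≤ n
      left-avoider  : IsAvoider (length left) left
      right-avoider : IsAvoider (n ∸ length left) right
      π≡glue        : π ≡ glue n (length left) left right

  max-decomposition : ∀ {n π} → IsAvoider (suc n) π → MaxDecomposition n π
  max-decomposition {n} av with ∈-∃++ (max-∈ av)
  ... | α , γ , refl = record
    { left = α ; right = map (_∸ length α) γ ; length≤ = k≤n
    ; left-avoider = left-avoider ; right-avoider = right-avoider ; π≡glue = glue-decomposition }
    where open MaxSplit α γ av

  pairs : ℕ → List (List ℕ × List ℕ)
  pairs n = concatMap (λ k → cartesianProduct (avoiders231 k) (avoiders231 (n ∸ k))) (upTo (suc n))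

  glue-pair : ℕ → List ℕ × List ℕ → List ℕ
  glue-pair n (α , β) = glue n (length α) α β

  ∈-pairs⁻ : ∀ n {α β} → (α , β) ∈ pairs n → ∃[ k ] k < suc n × α ∈ avoiders231 k × β ∈ avoiders231 (n ∸ k)
  ∈-pairs⁻ n p with find (∈-concatMap⁻ (λ k → cartesianProduct (avoiders231 k) (avoiders231 (n ∸ k))) {xs = upTo (suc n)} p)
  ... | k , k∈ , q = k , ∈-upTo⁻ k∈ , ∈-cartesianProduct⁻ (avoiders231 k) (avoiders231 (n ∸ k)) q

  ∈-pairs⁺ : ∀ n {k α β} → k < suc n → α ∈ avoiders231 k → β ∈ avoiders231 (n ∸ k) → (α , β) ∈ pairs n
  ∈-pairs⁺ n k<1+n α∈ β∈ = ∈-concatMap⁺ (λ k → cartesianProduct (avoiders231 k) (avoiders231 (n ∸ k)))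
    (lose (∈-upTo⁺ k<1+n) (∈-cartesianProduct⁺ α∈ β∈))

  split-at-max-unique : ∀ n {α α' γ γ'} → All (_< n) α → All (_< n) α' → α ++ n ∷ γ ≡ α' ++ n ∷ γ' → α ≡ α' × γ ≡ γ'
  split-at-max-unique n {[]}    {[]}      _           _             refl = refl , refl
  split-at-max-unique n {[]}    {_ ∷ _}   _           (a'<n ∷ _)    refl = ⊥-elim (<-irrefl refl a'<n)
  split-at-max-unique n {_ ∷ _} {[]}      (a<n ∷ _)   _             refl = ⊥-elim (<-irrefl refl a<n)
  split-at-max-unique n {_ ∷ _} {_ ∷ _}   (_ ∷ α<n)   (_ ∷ α'<n)    e with ∷-injective e
  ... | refl , e' with split-at-max-unique n α<n α'<n e'
  ...   | refl , refl = refl , refl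

  pairs-unique : ∀ n → Unique (pairs n)
  pairs-unique n = Unique.concat⁺ (blocks-unique (upTo (suc n)))
    (subst (AllPairs Disjoint) (sym (map-applyUpTo id block (suc n))) (AllPairs.applyUpTo⁺₁ block (suc n) disjoint))
    where
    block : ℕ → List (List ℕ × List ℕ)
    block k = cartesianProduct (avoiders231 k) (avoiders231 (n ∸ k))
    blocks-unique : ∀ ks → All Unique (map block ks)
    blocks-unique []       = []
    blocks-unique (k ∷ ks) = Unique.cartesianProduct⁺ (avoiders231-unique k) (avoiders231-unique (n ∸ k)) ∷ blocks-unique ks
    size : ∀ {k α β} → (α , β) ∈ block k → length α ≡ k
    size {k} p = IsAvoider.length≡ (∈-avoiders231⁻ k (proj₁ (∈-cartesianProduct⁻ (avoiders231 k) _ p)))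
    disjoint : ∀ {i j} → i < j → j < suc n → Disjoint (block i) (block j)
    disjoint i<j _ (p , q) = <-irrefl (trans (sym (size p)) (size q)) i<j

  glued-pairs-unique : ∀ n → Unique (map (glue-pair n) (pairs n))
  glued-pairs-unique n = Unique-map⁺ (glue-pair n) (pairs-unique n) injective
    where
    left<n : ∀ {α β} → (α , β) ∈ pairs n → All (_< n) α
    left<n p with ∈-pairs⁻ n p
    ... | k , k<1+n , α∈ , _ = All.map (λ a<k → <-≤-trans a<k (s≤s⁻¹ k<1+n)) (IsAvoider.bounded (∈-avoiders231⁻ k α∈))
    injective : ∀ {x y} → x ∈ pairs n → y ∈ pairs n → glue-pair n x ≡ glue-pair n y → x ≡ y
    injective {α , β} {α' , β'} p q e with split-at-max-unique n (left<n p) (left<n q) e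
    ... | refl , e' = cong (α ,_) (map-injective (+-cancelˡ-≡ (length α) _ _) e')

  ∈-glued-pairs⇔ : ∀ n {π} → π ∈ avoiders231 (suc n) ⇔ π ∈ map (glue-pair n) (pairs n)
  ∈-glued-pairs⇔ n {π} = mk⇔ to from
    where
    to : π ∈ avoiders231 (suc n) → π ∈ map (glue-pair n) (pairs n)
    to π∈ with max-decomposition (∈-avoiders231⁻ (suc n) π∈)
    ... | record { left = α ; right = β ; length≤ = k≤n ; left-avoider = α-av ; right-avoider = β-av ; π≡glue = refl } =
      ∈-map⁺ (glue-pair n) (∈-pairs⁺ n (s≤s k≤n) (∈-avoiders231⁺ _ α-av) (∈-avoiders231⁺ _ β-av))
    from : π ∈ map (glue-pair n) (pairs n) → π ∈ avoiders231 (suc n)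
    from π∈ with ∈-map⁻ (glue-pair n) π∈
    ... | (α , β) , αβ∈ , refl with ∈-pairs⁻ n αβ∈
    ...   | k , k<1+n , α∈ , β∈ with ∈-avoiders231⁻ k α∈
    ...     | α-av@(avoider refl _ _ _) = ∈-avoiders231⁺ (suc n) (glue-avoider (s≤s⁻¹ k<1+n) α-av (∈-avoiders231⁻ _ β∈))

  avoiders231-suc↭ : ∀ n → avoiders231 (suc n) ↭ map (glue-pair n) (pairs n)
  avoiders231-suc↭ n = ∼bag⇒↭ (unique∧set⇒bag (avoiders231-unique (suc n)) (glued-pairs-unique n) (∈-glued-pairs⇔ n))


module Statistics where

  open import Defs
  open Avoiders
  open Decomposition using (glue)
  open Pattern231 using (<ᵇ-+ˡ)
  open import Data.Bool using (true; false; T; T?)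
  open import Data.Empty using (⊥-elim)
  open import Data.List using (List; []; _∷_; map; length; _++_; reverse; filterᵇ; [_])
  open import Data.List.Properties using (filter-++; length-++; ++-assoc; reverse-++; unfold-reverse; reverse-map; length-reverse)
  open import Data.List.Relation.Unary.All as All using (All; []; _∷_)
  open import Data.List.Relation.Unary.Any.Properties using (reverse⁻)
  open import Data.Nat using (ℕ; zero; suc; _≤_; _<_; _<ᵇ_; _∸_; _+_; _*_)
  open import Data.Nat.Properties
  open import Function using (_∘_; id)
  open import Relation.Binary.PropositionalEquality hiding ([_])
  open ≡-Reasoning

  sgn δ₀ δ₁ : ℕ → ℕ
  sgn zero    = 0
  sgn (suc _) = 1
  δ₀ zero    = 1
  δ₀ (suc _) = 0
  δ₁ (suc zero) = 1
  δ₁ _          = 0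

  GlueLaw : (List ℕ → ℕ) → (ℕ → ℕ) → (ℕ → ℕ) → Set
  GlueLaw s u v = ∀ {n k α β} → k ≤ n → IsAvoider k α → IsAvoider (n ∸ k) β
    → s (glue n k α β) ≡ u k * v (n ∸ k) + s β

  count-++ : ∀ p xs ys → count p (xs ++ ys) ≡ count p xs + count p ys
  count-++ p xs ys = trans (cong length (filter-++ (T? ∘ p) xs ys)) (length-++ (filterᵇ p xs))

  count-true : ∀ p {xs} → All (λ x → p x ≡ true) xs → count p xs ≡ length xs
  count-true p []       = refl
  count-true p (e ∷ es) rewrite e = cong suc (count-true p es)

  count-false : ∀ p {xs} → All (λ x → p x ≡ false) xs → count p xs ≡ 0
  count-false p []       = refl
  count-false p (e ∷ es) rewrite e = count-false p es

  count-map : ∀ p q f xs → (∀ x → p (f x) ≡ q x) → count p (map f xs) ≡ count q xs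
  count-map p q f []       e = refl
  count-map p q f (x ∷ xs) e with p (f x) | q x | e x
  ... | true  | true  | refl = cong suc (count-map p q f xs e)
  ... | false | false | refl = count-map p q f xs e

  All-reverse : ∀ {P : ℕ → Set} {xs} → All P xs → All P (reverse xs)
  All-reverse all = All.tabulate (All.lookup all ∘ reverse⁻)

  <ᵇ-true : ∀ {a b} → a < b → (a <ᵇ b) ≡ true
  <ᵇ-true {a} {b} a<b with a <ᵇ b | <⇒<ᵇ a<b
  ... | true | _ = refl

  <ᵇ-false : ∀ {a b} → b ≤ a → (a <ᵇ b) ≡ false
  <ᵇ-false {a} {b} b≤a with a <ᵇ b in eq
  ... | false = refl
  ... | true  = ⊥-elim (<⇒≱ (<ᵇ⇒< a b (subst T (sym eq) _)) b≤a)

  reverse-glue : ∀ n k α β → reverse (glue n k α β) ≡ map (k +_) (reverse β) ++ n ∷ reverse α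
  reverse-glue n k α β = begin
    reverse (α ++ n ∷ map (k +_) β)                    ≡⟨ reverse-++ α (n ∷ map (k +_) β) ⟩
    reverse (n ∷ map (k +_) β) ++ reverse α            ≡⟨ cong (_++ reverse α) (unfold-reverse n (map (k +_) β)) ⟩
    (reverse (map (k +_) β) ++ [ n ]) ++ reverse α     ≡⟨ ++-assoc (reverse (map (k +_) β)) [ n ] (reverse α) ⟩
    reverse (map (k +_) β) ++ n ∷ reverse α            ≡⟨ cong (_++ n ∷ reverse α) (reverse-map (k +_) β) ⟨
    map (k +_) (reverse β) ++ n ∷ reverse α            ∎

  rev-1-2] rev-2-1] rev12] rev21] : List ℕ → ℕ
  rev-1-2] []       = 0
  rev-1-2] (x ∷ xs) = count (_<ᵇ x) xs
  rev-2-1] []       = 0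
  rev-2-1] (x ∷ xs) = count (x <ᵇ_) xs
  rev12] (x ∷ y ∷ _) = b2n (y <ᵇ x)
  rev12] _           = 0
  rev21] (x ∷ y ∷ _) = b2n (x <ᵇ y)
  rev21] _           = 0

  stat-1-2]-reverse : ∀ π → stat-1-2] π ≡ rev-1-2] (reverse π)
  stat-1-2]-reverse π with reverse π
  ... | []    = refl
  ... | _ ∷ _ = refl

  stat-2-1]-reverse : ∀ π → stat-2-1] π ≡ rev-2-1] (reverse π)
  stat-2-1]-reverse π with reverse π
  ... | []    = refl
  ... | _ ∷ _ = refl

  stat12]-reverse : ∀ π → stat12] π ≡ rev12] (reverse π)
  stat12]-reverse π with reverse π
  ... | []        = refl
  ... | _ ∷ []    = refl
  ... | _ ∷ _ ∷ _ = refl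

  stat21]-reverse : ∀ π → stat21] π ≡ rev21] (reverse π)
  stat21]-reverse π with reverse π
  ... | []        = refl
  ... | _ ∷ []    = refl
  ... | _ ∷ _ ∷ _ = refl

  ReversedGlueLaw : (List ℕ → ℕ) → (ℕ → ℕ) → (ℕ → ℕ) → Set
  ReversedGlueLaw s u v = ∀ {n k r L} → k ≤ n → All (_< k) r → length r ≡ k → All (λ x → k + x < n) L
    → s (map (k +_) L ++ n ∷ r) ≡ u k * v (length L) + s L

  glue-law-from-reverse : ∀ {s s' u v} → (∀ π → s π ≡ s' (reverse π)) → ReversedGlueLaw s' u v → GlueLaw s u v
  glue-law-from-reverse {s} {s'} {u} {v} s-reverse law {n} {k} {α} {β} k≤n
    (avoider refl α<k _ _) (avoider β-length β<n∸k _ _) = begin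
    s (glue n k α β)                                ≡⟨ s-reverse (glue n k α β) ⟩
    s' (reverse (glue n k α β))                     ≡⟨ cong s' (reverse-glue n k α β) ⟩
    s' (map (k +_) (reverse β) ++ n ∷ reverse α)
      ≡⟨ law k≤n (All-reverse α<k) (length-reverse α) (All-reverse shifted<n) ⟩
    u k * v (length (reverse β)) + s' (reverse β)
      ≡⟨ cong₂ (λ l t → u k * v l + t) (trans (length-reverse β) β-length) (sym (s-reverse β)) ⟩
    u k * v (n ∸ k) + s β                           ∎
    where
    shifted<n : All (λ x → k + x < n) β
    shifted<n = All.map (λ {b} b<n∸k → subst (k + b <_) (m+[n∸m]≡n k≤n) (+-monoʳ-< k b<n∸k)) β<n∸k

  rev-1-2]-glued : ReversedGlueLaw rev-1-2] id (λ _ → 1)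
  rev-1-2]-glued {n} {k} {r} {[]} k≤n r<k r-length _ = begin
    count (_<ᵇ n) r    ≡⟨ count-true (_<ᵇ n) (All.map (λ y<k → <ᵇ-true (<-≤-trans y<k k≤n)) r<k) ⟩
    length r           ≡⟨ r-length ⟩
    k                  ≡⟨ trans (+-identityʳ (k * 1)) (*-identityʳ k) ⟨
    k * 1 + 0          ∎
  rev-1-2]-glued {n} {k} {r} {x ∷ L} k≤n r<k r-length (k+x<n ∷ _) = begin
    count (_<ᵇ (k + x)) (map (k +_) L ++ n ∷ r)
      ≡⟨ count-++ (_<ᵇ (k + x)) (map (k +_) L) (n ∷ r) ⟩
    count (_<ᵇ (k + x)) (map (k +_) L) + count (_<ᵇ (k + x)) (n ∷ r)
      ≡⟨ cong₂ _+_ (count-map (_<ᵇ (k + x)) (_<ᵇ x) (k +_) L (λ y → <ᵇ-+ˡ k y x)) below-k+x ⟩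
    count (_<ᵇ x) L + k
      ≡⟨ trans (+-comm _ k) (cong (_+ count (_<ᵇ x) L) (sym (*-identityʳ k))) ⟩
    k * 1 + count (_<ᵇ x) L ∎
    where
    below-k+x : count (_<ᵇ (k + x)) (n ∷ r) ≡ k
    below-k+x rewrite <ᵇ-false {n} {k + x} (<⇒≤ k+x<n) =
      trans (count-true _ (All.map (λ y<k → <ᵇ-true (<-≤-trans y<k (m≤m+n k x))) r<k)) r-length

  rev-2-1]-glued : ReversedGlueLaw rev-2-1] (λ _ → 1) sgn
  rev-2-1]-glued {n} {k} {r} {[]} k≤n r<k _ _ =
    count-false (n <ᵇ_) (All.map (λ y<k → <ᵇ-false (<⇒≤ (<-≤-trans y<k k≤n))) r<k)
  rev-2-1]-glued {n} {k} {r} {x ∷ L} k≤n r<k _ (k+x<n ∷ _) = begin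
    count ((k + x) <ᵇ_) (map (k +_) L ++ n ∷ r)
      ≡⟨ count-++ ((k + x) <ᵇ_) (map (k +_) L) (n ∷ r) ⟩
    count ((k + x) <ᵇ_) (map (k +_) L) + count ((k + x) <ᵇ_) (n ∷ r)
      ≡⟨ cong₂ _+_ (count-map ((k + x) <ᵇ_) (x <ᵇ_) (k +_) L (<ᵇ-+ˡ k x)) above-k+x ⟩
    count (x <ᵇ_) L + 1
      ≡⟨ +-comm _ 1 ⟩
    1 + count (x <ᵇ_) L ∎
    where
    above-k+x : count ((k + x) <ᵇ_) (n ∷ r) ≡ 1
    above-k+x rewrite <ᵇ-true k+x<n =
      cong suc (count-false _ (All.map (λ y<k → <ᵇ-false (≤-trans (<⇒≤ y<k) (m≤m+n k x))) r<k))

  rev12]-glued : ReversedGlueLaw rev12] sgn δ₀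
  rev12]-glued {r = []}    {[]}        _   _           refl _ = refl
  rev12]-glued {r = y ∷ _} {[]}        k≤n (y<k ∷ _)   refl _ rewrite <ᵇ-true (<-≤-trans y<k k≤n) = refl
  rev12]-glued {n} {k}     {L = x ∷ []} _  _           _    (k+x<n ∷ _)
    rewrite <ᵇ-false {n} {k + x} (<⇒≤ k+x<n) = sym (trans (+-identityʳ (sgn k * 0)) (*-zeroʳ (sgn k)))
  rev12]-glued {k = k}     {L = x ∷ y ∷ _} _ _ _ _
    rewrite <ᵇ-+ˡ k y x = sym (cong (_+ b2n (y <ᵇ x)) (*-zeroʳ (sgn k)))

  rev21]-glued : ReversedGlueLaw rev21] (λ _ → 1) δ₁
  rev21]-glued {r = []}    {[]}        _   _          refl _ = refl
  rev21]-glued {n}         {r = y ∷ _} {[]} k≤n (y<k ∷ _) refl _ rewrite <ᵇ-false {n} {y} (<⇒≤ (<-≤-trans y<k k≤n)) = refl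
  rev21]-glued {n} {k}     {L = x ∷ []} _  _          _    (k+x<n ∷ _) rewrite <ᵇ-true k+x<n = refl
  rev21]-glued {k = k}     {L = x ∷ y ∷ _} _ _ _ _ rewrite <ᵇ-+ˡ k x y = refl

  stat-1-2]-glue : GlueLaw stat-1-2] id (λ _ → 1)
  stat-1-2]-glue = glue-law-from-reverse {s' = rev-1-2]} {u = id} {v = λ _ → 1} stat-1-2]-reverse rev-1-2]-glued

  stat-2-1]-glue : GlueLaw stat-2-1] (λ _ → 1) sgn
  stat-2-1]-glue = glue-law-from-reverse {s' = rev-2-1]} {u = λ _ → 1} {v = sgn} stat-2-1]-reverse rev-2-1]-glued

  stat12]-glue : GlueLaw stat12] sgn δ₀
  stat12]-glue = glue-law-from-reverse {s' = rev12]} {u = sgn} {v = δ₀} stat12]-reverse rev12]-glued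

  stat21]-glue : GlueLaw stat21] (λ _ → 1) δ₁
  stat21]-glue = glue-law-from-reverse {s' = rev21]} {u = λ _ → 1} {v = δ₁} stat21]-reverse rev21]-glued


module Enumeration where

  open import Defs
  open Avoiders
  open Decomposition
  open Statistics
  open import Data.List using (List; []; _∷_; map; length; _++_; concatMap; cartesianProduct; upTo; foldr)
  open import Data.List.Membership.Propositional using (_∈_)
  open import Data.List.Membership.Propositional.Properties using (∈-upTo⁻)
  open import Data.List.Relation.Binary.Permutation.Propositional using (_↭_; refl; prep; swap; trans)
  open import Data.List.Relation.Unary.Any using (here; there)
  open import Data.Nat using (ℕ; suc; _∸_; _+_; _*_; _<_; s≤s⁻¹)
  open import Data.Nat.Properties
  open import Data.Nat.Tactic.RingSolver using (solve-∀)
  open import Algebra.Properties.CommutativeSemigroup +-commutativeSemigroup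
    using () renaming (interchange to +-interchange; x∙yz≈y∙xz to x+yz≈y+xz)
  open import Data.Product using (_×_; _,_)
  open import Function using (_∘_)
  open import Relation.Binary.PropositionalEquality as ≡ using (_≡_; cong; cong₂; sym)
  open ≡.≡-Reasoning

  sumBy : {A : Set} → (A → ℕ) → List A → ℕ
  sumBy f = foldr (λ x acc → f x + acc) 0

  sumBy-↭ : ∀ {A : Set} (f : A → ℕ) {xs ys} → xs ↭ ys → sumBy f xs ≡ sumBy f ys
  sumBy-↭ f refl         = ≡.refl
  sumBy-↭ f (prep x p)   = cong (f x +_) (sumBy-↭ f p)
  sumBy-↭ f (swap x y p) = ≡.trans (x+yz≈y+xz (f x) (f y) _) (cong (λ t → f y + (f x + t)) (sumBy-↭ f p))
  sumBy-↭ f (trans p q)  = ≡.trans (sumBy-↭ f p) (sumBy-↭ f q)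

  sumBy-map : ∀ {A B : Set} (f : B → ℕ) (g : A → B) xs → sumBy f (map g xs) ≡ sumBy (f ∘ g) xs
  sumBy-map f g []       = ≡.refl
  sumBy-map f g (x ∷ xs) = cong (f (g x) +_) (sumBy-map f g xs)

  sumBy-++ : ∀ {A : Set} (f : A → ℕ) xs ys → sumBy f (xs ++ ys) ≡ sumBy f xs + sumBy f ys
  sumBy-++ f []       ys = ≡.refl
  sumBy-++ f (x ∷ xs) ys = ≡.trans (cong (f x +_) (sumBy-++ f xs ys)) (sym (+-assoc (f x) _ _))

  sumBy-concatMap : ∀ {A B : Set} (f : B → ℕ) (g : A → List B) xs → sumBy f (concatMap g xs) ≡ sumBy (sumBy f ∘ g) xs
  sumBy-concatMap f g []       = ≡.refl
  sumBy-concatMap f g (x ∷ xs) = ≡.trans (sumBy-++ f (g x) (concatMap g xs)) (cong (sumBy f (g x) +_) (sumBy-concatMap f g xs))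

  sumBy-cartesianProduct : ∀ {A B : Set} (f : A × B → ℕ) xs ys
    → sumBy f (cartesianProduct xs ys) ≡ sumBy (λ x → sumBy (λ y → f (x , y)) ys) xs
  sumBy-cartesianProduct f []       ys = ≡.refl
  sumBy-cartesianProduct f (x ∷ xs) ys =
    ≡.trans (sumBy-++ f (map (x ,_) ys) _) (cong₂ _+_ (sumBy-map f (x ,_) ys) (sumBy-cartesianProduct f xs ys))

  sumBy-cong : ∀ {A : Set} {f g : A → ℕ} xs → (∀ {x} → x ∈ xs → f x ≡ g x) → sumBy f xs ≡ sumBy g xs
  sumBy-cong []       e = ≡.refl
  sumBy-cong (x ∷ xs) e = cong₂ _+_ (e (here ≡.refl)) (sumBy-cong xs (e ∘ there))

  sumBy-const : ∀ {A : Set} c (xs : List A) → sumBy (λ _ → c) xs ≡ length xs * c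
  sumBy-const c []       = ≡.refl
  sumBy-const c (x ∷ xs) = cong (c +_) (sumBy-const c xs)

  sumBy-+ : ∀ {A : Set} (f g : A → ℕ) xs → sumBy (λ x → f x + g x) xs ≡ sumBy f xs + sumBy g xs
  sumBy-+ f g []       = ≡.refl
  sumBy-+ f g (x ∷ xs) = ≡.trans (cong (f x + g x +_) (sumBy-+ f g xs)) (+-interchange (f x) (g x) _ _)

  card : ℕ → ℕ
  card m = length (avoiders231 m)

  total-suc : ∀ {s u v} → GlueLaw s u v → ∀ n → total s (avoiders231 (suc n))
    ≡ sumBy (λ k → card k * u k * (card (n ∸ k) * v (n ∸ k)) + card k * total s (avoiders231 (n ∸ k))) (upTo (suc n))
  total-suc {s} {u} {v} law n = begin
    sumBy s (avoiders231 (suc n))                     ≡⟨ sumBy-↭ s (avoiders231-suc↭ n) ⟩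
    sumBy s (map (glue-pair n) (pairs n))             ≡⟨ sumBy-map s (glue-pair n) (pairs n) ⟩
    sumBy (s ∘ glue-pair n) (pairs n)                 ≡⟨ sumBy-concatMap (s ∘ glue-pair n) block (upTo (suc n)) ⟩
    sumBy (sumBy (s ∘ glue-pair n) ∘ block) (upTo (suc n))
      ≡⟨ sumBy-cong (upTo (suc n)) (λ k∈ → block-sum (∈-upTo⁻ k∈)) ⟩
    sumBy (λ k → card k * u k * (card (n ∸ k) * v (n ∸ k)) + card k * total s (avoiders231 (n ∸ k))) (upTo (suc n)) ∎
    where
    block : ℕ → List (List ℕ × List ℕ)
    block k = cartesianProduct (avoiders231 k) (avoiders231 (n ∸ k))
    regroup : ∀ a b w t → a * (b * w + t) ≡ a * w * b + a * t
    regroup = solve-∀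
    block-sum : ∀ {k} → k < suc n → sumBy (s ∘ glue-pair n) (block k)
      ≡ card k * u k * (card (n ∸ k) * v (n ∸ k)) + card k * total s (avoiders231 (n ∸ k))
    block-sum {k} k<1+n = begin
      sumBy (s ∘ glue-pair n) (block k)
        ≡⟨ sumBy-cartesianProduct (s ∘ glue-pair n) (avoiders231 k) (avoiders231 (n ∸ k)) ⟩
      sumBy (λ α → sumBy (λ β → s (glue-pair n (α , β))) (avoiders231 (n ∸ k))) (avoiders231 k)
        ≡⟨ sumBy-cong (avoiders231 k) (λ α∈ → sumBy-cong (avoiders231 (n ∸ k)) (λ β∈ →
             glued α∈ (∈-avoiders231⁻ (n ∸ k) β∈))) ⟩
      sumBy (λ _ → sumBy (λ β → u k * v (n ∸ k) + s β) (avoiders231 (n ∸ k))) (avoiders231 k)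
        ≡⟨ sumBy-const _ (avoiders231 k) ⟩
      card k * sumBy (λ β → u k * v (n ∸ k) + s β) (avoiders231 (n ∸ k))
        ≡⟨ cong (card k *_) (≡.trans (sumBy-+ (λ _ → u k * v (n ∸ k)) s (avoiders231 (n ∸ k)))
                                    (cong (_+ total s (avoiders231 (n ∸ k))) (sumBy-const _ (avoiders231 (n ∸ k))))) ⟩
      card k * (card (n ∸ k) * (u k * v (n ∸ k)) + total s (avoiders231 (n ∸ k)))
        ≡⟨ regroup (card k) (card (n ∸ k)) (u k * v (n ∸ k)) _ ⟩
      card k * (u k * v (n ∸ k)) * card (n ∸ k) + card k * total s (avoiders231 (n ∸ k))
        ≡⟨ cong (_+ card k * total s (avoiders231 (n ∸ k))) (rearrange (card k) (u k) (v (n ∸ k)) (card (n ∸ k))) ⟩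
      card k * u k * (card (n ∸ k) * v (n ∸ k)) + card k * total s (avoiders231 (n ∸ k)) ∎
      where
      rearrange : ∀ a x y b → a * (x * y) * b ≡ a * x * (b * y)
      rearrange = solve-∀
      glued : ∀ {α β} → α ∈ avoiders231 k → IsAvoider (n ∸ k) β → s (glue-pair n (α , β)) ≡ u k * v (n ∸ k) + s β
      glued α∈ β-av with ∈-avoiders231⁻ k α∈
      ... | α-av@(avoider ≡.refl _ _ _) = law (s≤s⁻¹ k<1+n) α-av β-av


module GeneratingFunctions where

  open import Defs
  open PowerSeries
  open Avoiders
  open Statistics
  open Enumeration
  open import Data.Integer using (ℤ; +_; _+_; _*_)
  import Data.Integer.Properties as ℤ
  open import Data.Integer.Tactic.RingSolver using (solve-∀)
  open import Data.List using (applyUpTo; upTo)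
  open import Data.Nat using (ℕ; zero; suc; _∸_)
  import Data.Nat as ℕ
  import Data.Nat.Properties as ℕ
  open import Function using (_∘_; id)
  open import Relation.Binary.PropositionalEquality
  open ≡-Reasoning

  ⟦_⟧ : (ℕ → ℕ) → Series
  ⟦ f ⟧ k = + f k

  sumBy-applyUpTo : ∀ (h g : ℕ → ℕ) m → + sumBy h (applyUpTo g m) ≡ sumUpTo (λ k → + h (g k)) m
  sumBy-applyUpTo h g zero    = refl
  sumBy-applyUpTo h g (suc m) = trans (ℤ.pos-+ (h (g 0)) _) (cong (_+_ (+ h (g 0))) (sumBy-applyUpTo h (g ∘ suc) m))

  sumBy-convolution : ∀ (f g : ℕ → ℕ) n → + sumBy (λ k → f k ℕ.* g (n ∸ k)) (upTo (suc n)) ≡ (⟦ f ⟧ *ₛ ⟦ g ⟧) n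
  sumBy-convolution f g n = begin
    + sumBy (λ k → f k ℕ.* g (n ∸ k)) (upTo (suc n))    ≡⟨ sumBy-applyUpTo (λ k → f k ℕ.* g (n ∸ k)) id (suc n) ⟩
    sumUpTo (λ k → + (f k ℕ.* g (n ∸ k))) (suc n)       ≡⟨ sumUpTo-cong (suc n) (λ k _ → ℤ.pos-* (f k) (g (n ∸ k))) ⟩
    sumUpTo (λ k → + f k * + g (n ∸ k)) (suc n)         ≡⟨ *ₛ-as-sum ⟦ f ⟧ ⟦ g ⟧ n ⟨
    (⟦ f ⟧ *ₛ ⟦ g ⟧) n                                  ∎

  A : Series
  A = ⟦ card ⟧

  weighted : (ℕ → ℕ) → Series
  weighted u = ⟦ (λ k → card k ℕ.* u k) ⟧

  gf-suc : ∀ {s u v} → GlueLaw s u v → ∀ n → gf s (suc n) ≡ (weighted u *ₛ weighted v +ₛ A *ₛ gf s) n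
  gf-suc {s} {u} {v} law n = begin
    + total s (avoiders231 (suc n))
      ≡⟨ cong +_ (trans (total-suc {s} {u} {v} law n) (sumBy-+ glued rest (upTo (suc n)))) ⟩
    + (sumBy glued (upTo (suc n)) ℕ.+ sumBy rest (upTo (suc n)))
      ≡⟨ ℤ.pos-+ (sumBy glued (upTo (suc n))) _ ⟩
    + sumBy glued (upTo (suc n)) + + sumBy rest (upTo (suc n))
      ≡⟨ cong₂ _+_ (sumBy-convolution (λ k → card k ℕ.* u k) (λ m → card m ℕ.* v m) n)
                   (sumBy-convolution card (λ m → total s (avoiders231 m)) n) ⟩
    (weighted u *ₛ weighted v +ₛ A *ₛ gf s) n ∎
    where
    glued rest : ℕ → ℕ
    glued k = card k ℕ.* u k ℕ.* (card (n ∸ k) ℕ.* v (n ∸ k))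
    rest  k = card k ℕ.* total s (avoiders231 (n ∸ k))

  gf-equation : ∀ {s u v} → GlueLaw s u v → gf s 0 ≡ + 0 → gf s ≈ₛ Z *ₛ (weighted u *ₛ weighted v +ₛ A *ₛ gf s)
  gf-equation {s} {u} {v} law gf₀≡0 = ≈ₛ-Z*ₛ gf₀≡0 (gf-suc {s} {u} {v} law)

  -- The constant statistic 1 glues with weight 0 and has total card.
  A-suc : ∀ n → A (suc n) ≡ (A *ₛ A) n
  A-suc n = begin
    + card (suc n)                                        ≡⟨ cong +_ (card≡total (suc n)) ⟩
    gf (λ _ → 1) (suc n)                                  ≡⟨ gf-suc {λ _ → 1} {λ _ → 0} {λ _ → 0} (λ _ _ _ → refl) n ⟩
    (weighted (λ _ → 0) *ₛ weighted (λ _ → 0) +ₛ A *ₛ gf (λ _ → 1)) n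
      ≡⟨ cong₂ _+_ (*ₛ-zeroˡ (weighted (λ _ → 0)) (λ k → cong +_ (ℕ.*-zeroʳ (card k))) n)
                   ((≈ₛ-refl {A} ⟨*⟩ λ m → cong +_ (sym (card≡total m))) n) ⟩
    + 0 + (A *ₛ A) n                                      ≡⟨ ℤ.+-identityˡ _ ⟩
    (A *ₛ A) n                                            ∎
    where
    card≡total : ∀ m → card m ≡ total (λ _ → 1) (avoiders231 m)
    card≡total m = sym (trans (sumBy-const 1 (avoiders231 m)) (ℕ.*-identityʳ (card m)))

  A-equation : A ≈ₛ 𝟙 +ₛ Z *ₛ (A *ₛ A)
  A-equation zero    = sym (cong (_+_ (+ 1)) (Z*ₛ-zero (A *ₛ A)))
  A-equation (suc n) = trans (A-suc n) (sym (trans (ℤ.+-identityˡ _) (Z*ₛ-suc (A *ₛ A) n)))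

  θA-equation : θ A ≈ₛ Z *ₛ (A *ₛ A +ₛ (A +ₛ A) *ₛ θ A)
  θA-equation = ≈ₛ-Z*ₛ refl λ n → let x = (A *ₛ A) n in begin
    + suc n * A (suc n)                    ≡⟨ cong₂ _*_ (ℤ.pos-+ 1 n) (A-suc n) ⟩
    (+ 1 + + n) * x                        ≡⟨ distribute (+ n) x ⟩
    x + + n * x                            ≡⟨ cong (_+_ x) (θ-*ₛ A A n) ⟩
    x + (θ A *ₛ A +ₛ A *ₛ θ A) n           ≡⟨ cong (_+_ x) (cong (_+ (A *ₛ θ A) n) (*ₛ-comm (θ A) A n)) ⟩
    x + (A *ₛ θ A +ₛ A *ₛ θ A) n           ≡⟨ cong (_+_ x) (*ₛ-distribʳ (θ A) A A n) ⟨
    x + ((A +ₛ A) *ₛ θ A) n                ∎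
    where
    distribute : ∀ m y → (+ 1 + m) * y ≡ y + m * y
    distribute = solve-∀

  weighted-id : weighted id ≈ₛ θ A
  weighted-id k = trans (cong +_ (ℕ.*-comm (card k) k)) (ℤ.pos-* k (card k))

  weighted-one : weighted (λ _ → 1) ≈ₛ A
  weighted-one k = cong +_ (ℕ.*-identityʳ (card k))

  weighted-sgn : weighted sgn ≈ₛ Z *ₛ (A *ₛ A)
  weighted-sgn = ≈ₛ-Z*ₛ refl (λ n → trans (weighted-one (suc n)) (A-suc n))

  weighted-δ₀ : weighted δ₀ ≈ₛ 𝟙
  weighted-δ₀ zero    = refl
  weighted-δ₀ (suc n) = cong +_ (ℕ.*-zeroʳ (card (suc n)))

  weighted-δ₁ : weighted δ₁ ≈ₛ Z
  weighted-δ₁ zero          = refl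
  weighted-δ₁ (suc zero)    = refl
  weighted-δ₁ (suc (suc n)) = cong +_ (ℕ.*-zeroʳ (card (suc (suc n))))


open import Defs
open PowerSeries
open SquareRoot
open Statistics
open GeneratingFunctions
open import Algebra.Bundles using (CommutativeSemiring)
open import Data.Integer using (+_)
open import Data.Product using (_×_; _,_)
open import Function using (id)
open import Relation.Binary.PropositionalEquality using (_≡_; refl)
open import Relation.Binary.Reasoning.Setoid (CommutativeSemiring.setoid series-commutativeSemiring)

module Solution {B C : Series}
  (C-equation : C ≈ₛ 𝟙 +ₛ Z *ₛ (C *ₛ C))
  (B-equation : B ≈ₛ 𝟙 +ₛ Z *ₛ (B *ₛ C +ₛ B *ₛ C)) where

  A≈C : A ≈ₛ C
  A≈C = quadratic-equation-unique A-equation C-equation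

  θA≈zBC² : θ A ≈ₛ Z *ₛ B *ₛ C *ₛ C
  θA≈zBC² = linear-equation-unique {P = C *ₛ C} {F = C +ₛ C}
    (begin
      θ A                                        ≈⟨ θA-equation ⟩
      Z *ₛ (A *ₛ A +ₛ (A +ₛ A) *ₛ θ A)           ≈⟨ ≈ₛ-refl {Z} ⟨*⟩ (A≈C ⟨*⟩ A≈C ⟨+⟩ (A≈C ⟨+⟩ A≈C) ⟨*⟩ ≈ₛ-refl {θ A}) ⟩
      Z *ₛ (C *ₛ C +ₛ (C +ₛ C) *ₛ θ A)           ∎)
    (begin
      Z *ₛ B *ₛ C *ₛ C                           ≈⟨ solve 3 (λ z b c → z :* b :* c :* c := z :* c :* c :* b) ≈ₛ-refl Z B C ⟩
      Z *ₛ C *ₛ C *ₛ B                           ≈⟨ ≈ₛ-refl {Z *ₛ C *ₛ C} ⟨*⟩ B-equation ⟩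
      Z *ₛ C *ₛ C *ₛ (𝟙 +ₛ Z *ₛ (B *ₛ C +ₛ B *ₛ C))
        ≈⟨ solve 3 (λ z b c → z :* c :* c :* (con 1 :+ z :* (b :* c :+ b :* c))
                            := z :* (c :* c :+ (c :+ c) :* (z :* b :* c :* c))) ≈ₛ-refl Z B C ⟩
      Z *ₛ (C *ₛ C +ₛ (C +ₛ C) *ₛ (Z *ₛ B *ₛ C *ₛ C)) ∎)

  gf-solution : ∀ {s u v} → GlueLaw s u v → gf s 0 ≡ + 0 → ∀ {P} Y
    → weighted u *ₛ weighted v ≈ₛ P → Y ≈ₛ Z *ₛ (P +ₛ C *ₛ Y) → gf s ≈ₛ Y
  gf-solution {s} {u} {v} law gf₀≡0 {P} Y uv≈P = linear-equation-unique {P = P} {F = C}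
    (begin
      gf s                                                  ≈⟨ gf-equation {s} {u} {v} law gf₀≡0 ⟩
      Z *ₛ (weighted u *ₛ weighted v +ₛ A *ₛ gf s)          ≈⟨ ≈ₛ-refl {Z} ⟨*⟩ (uv≈P ⟨+⟩ A≈C ⟨*⟩ ≈ₛ-refl {gf s}) ⟩
      Z *ₛ (P +ₛ C *ₛ gf s)                                 ∎)

  gf-stat-1-2] : gf stat-1-2] ≈ₛ z²· (B *ₛ C *ₛ C *ₛ C *ₛ C)
  gf-stat-1-2] = begin
    gf stat-1-2]
      ≈⟨ gf-solution {stat-1-2]} {id} {λ _ → 1} stat-1-2]-glue refl (Z *ₛ Z *ₛ B *ₛ C *ₛ C *ₛ C *ₛ C)
           (weighted-id ⟨*⟩ weighted-one ⟨≈⟩ θA≈zBC² ⟨*⟩ A≈C)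
           (begin
             Z *ₛ Z *ₛ B *ₛ C *ₛ C *ₛ C *ₛ C               ≈⟨ ≈ₛ-refl {Z *ₛ Z *ₛ B *ₛ C *ₛ C *ₛ C} ⟨*⟩ C-equation ⟩
             Z *ₛ Z *ₛ B *ₛ C *ₛ C *ₛ C *ₛ (𝟙 +ₛ Z *ₛ (C *ₛ C))
               ≈⟨ solve 3 (λ z b c → z :* z :* b :* c :* c :* c :* (con 1 :+ z :* (c :* c))
                                   := z :* (z :* b :* c :* c :* c :+ c :* (z :* z :* b :* c :* c :* c :* c))) ≈ₛ-refl Z B C ⟩
             Z *ₛ (Z *ₛ B *ₛ C *ₛ C *ₛ C +ₛ C *ₛ (Z *ₛ Z *ₛ B *ₛ C *ₛ C *ₛ C *ₛ C)) ∎) ⟩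
    Z *ₛ Z *ₛ B *ₛ C *ₛ C *ₛ C *ₛ C
      ≈⟨ solve 3 (λ z b c → z :* z :* b :* c :* c :* c :* c := z :* (z :* (b :* c :* c :* c :* c))) ≈ₛ-refl Z B C ⟩
    Z *ₛ (Z *ₛ (B *ₛ C *ₛ C *ₛ C *ₛ C))  ≈⟨ z²·≈Z*ₛZ*ₛ (B *ₛ C *ₛ C *ₛ C *ₛ C) ⟨
    z²· (B *ₛ C *ₛ C *ₛ C *ₛ C)          ∎

  gf-stat-2-1] : gf stat-2-1] ≈ₛ z²· (C *ₛ C *ₛ C *ₛ C)
  gf-stat-2-1] = begin
    gf stat-2-1]
      ≈⟨ gf-solution {stat-2-1]} {λ _ → 1} {sgn} stat-2-1]-glue refl (Z *ₛ Z *ₛ C *ₛ C *ₛ C *ₛ C)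
           (weighted-one ⟨*⟩ weighted-sgn ⟨≈⟩ A≈C ⟨*⟩ (≈ₛ-refl {Z} ⟨*⟩ (A≈C ⟨*⟩ A≈C)))
           (begin
             Z *ₛ Z *ₛ C *ₛ C *ₛ C *ₛ C                    ≈⟨ ≈ₛ-refl {Z *ₛ Z *ₛ C *ₛ C *ₛ C} ⟨*⟩ C-equation ⟩
             Z *ₛ Z *ₛ C *ₛ C *ₛ C *ₛ (𝟙 +ₛ Z *ₛ (C *ₛ C))
               ≈⟨ solve 2 (λ z c → z :* z :* c :* c :* c :* (con 1 :+ z :* (c :* c))
                                 := z :* (c :* (z :* (c :* c)) :+ c :* (z :* z :* c :* c :* c :* c))) ≈ₛ-refl Z C ⟩
             Z *ₛ (C *ₛ (Z *ₛ (C *ₛ C)) +ₛ C *ₛ (Z *ₛ Z *ₛ C *ₛ C *ₛ C *ₛ C)) ∎) ⟩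
    Z *ₛ Z *ₛ C *ₛ C *ₛ C *ₛ C
      ≈⟨ solve 2 (λ z c → z :* z :* c :* c :* c :* c := z :* (z :* (c :* c :* c :* c))) ≈ₛ-refl Z C ⟩
    Z *ₛ (Z *ₛ (C *ₛ C *ₛ C *ₛ C))       ≈⟨ z²·≈Z*ₛZ*ₛ (C *ₛ C *ₛ C *ₛ C) ⟨
    z²· (C *ₛ C *ₛ C *ₛ C)               ∎

  gf-stat12] : gf stat12] ≈ₛ z²· (C *ₛ C *ₛ C)
  gf-stat12] = begin
    gf stat12]
      ≈⟨ gf-solution {stat12]} {sgn} {δ₀} stat12]-glue refl (Z *ₛ Z *ₛ C *ₛ C *ₛ C)
           (weighted-sgn ⟨*⟩ weighted-δ₀ ⟨≈⟩ (≈ₛ-refl {Z} ⟨*⟩ (A≈C ⟨*⟩ A≈C)) ⟨*⟩ ≈ₛ-refl {𝟙})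
           (begin
             Z *ₛ Z *ₛ C *ₛ C *ₛ C                         ≈⟨ ≈ₛ-refl {Z *ₛ Z *ₛ C *ₛ C} ⟨*⟩ C-equation ⟩
             Z *ₛ Z *ₛ C *ₛ C *ₛ (𝟙 +ₛ Z *ₛ (C *ₛ C))
               ≈⟨ solve 2 (λ z c → z :* z :* c :* c :* (con 1 :+ z :* (c :* c))
                                 := z :* (z :* (c :* c) :* con 1 :+ c :* (z :* z :* c :* c :* c))) ≈ₛ-refl Z C ⟩
             Z *ₛ (Z *ₛ (C *ₛ C) *ₛ 𝟙 +ₛ C *ₛ (Z *ₛ Z *ₛ C *ₛ C *ₛ C)) ∎) ⟩
    Z *ₛ Z *ₛ C *ₛ C *ₛ C
      ≈⟨ solve 2 (λ z c → z :* z :* c :* c :* c := z :* (z :* (c :* c :* c))) ≈ₛ-refl Z C ⟩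
    Z *ₛ (Z *ₛ (C *ₛ C *ₛ C))            ≈⟨ z²·≈Z*ₛZ*ₛ (C *ₛ C *ₛ C) ⟨
    z²· (C *ₛ C *ₛ C)                    ∎

  gf-stat21] : gf stat21] ≈ₛ z²· (C *ₛ C)
  gf-stat21] = begin
    gf stat21]
      ≈⟨ gf-solution {stat21]} {λ _ → 1} {δ₁} stat21]-glue refl (Z *ₛ Z *ₛ C *ₛ C)
           (weighted-one ⟨*⟩ weighted-δ₁ ⟨≈⟩ A≈C ⟨*⟩ ≈ₛ-refl {Z})
           (begin
             Z *ₛ Z *ₛ C *ₛ C                              ≈⟨ ≈ₛ-refl {Z *ₛ Z *ₛ C} ⟨*⟩ C-equation ⟩
             Z *ₛ Z *ₛ C *ₛ (𝟙 +ₛ Z *ₛ (C *ₛ C))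
               ≈⟨ solve 2 (λ z c → z :* z :* c :* (con 1 :+ z :* (c :* c))
                                 := z :* (c :* z :+ c :* (z :* z :* c :* c))) ≈ₛ-refl Z C ⟩
             Z *ₛ (C *ₛ Z +ₛ C *ₛ (Z *ₛ Z *ₛ C *ₛ C)) ∎) ⟩
    Z *ₛ Z *ₛ C *ₛ C
      ≈⟨ solve 2 (λ z c → z :* z :* c :* c := z :* (z :* (c :* c))) ≈ₛ-refl Z C ⟩
    Z *ₛ (Z *ₛ (C *ₛ C))                 ≈⟨ z²·≈Z*ₛZ*ₛ (C *ₛ C) ⟨
    z²· (C *ₛ C)                         ∎

corollary3p8 : (S B C : Series)
    → S *ₛ S ≈ₛ const (+ 1) -ₛ cz (+ 4)
    → S 0 ≡ + 1
    → B *ₛ S ≈ₛ const (+ 1)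
    → cz (+ 2) *ₛ C ≈ₛ const (+ 1) -ₛ S
    → (gf stat-1-2] ≈ₛ z²· (B *ₛ C *ₛ C *ₛ C *ₛ C))
      × (gf stat-2-1] ≈ₛ z²· (C *ₛ C *ₛ C *ₛ C))
      × (gf stat12] ≈ₛ z²· (C *ₛ C *ₛ C))
      × (gf stat21] ≈ₛ z²· (C *ₛ C))
corollary3p8 S B C S²≈1-4z S₀≡1 B*S≈1 2zC≈1-S = gf-stat-1-2] , gf-stat-2-1] , gf-stat12] , gf-stat21]
  where
  open Solution (catalan-equation S B C S²≈1-4z S₀≡1 B*S≈1 2zC≈1-S) (B-equation S B C S²≈1-4z S₀≡1 B*S≈1 2zC≈1-S)
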